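{- Let $\mathcal{S}$ be a scroll with $(i,1)$ a live entry. Then the slither from $(i,1)$ is obtained as follows: traverse, from left to right, the $0$-blocks (maximal runs of consecutive $0$s between two consecutive live entries) entirely contained in row $i$; for each such $0$-block of size $z$, append $E$ if $z=1$ and append $DE^{\lfloor z/2\rfloor-1}D$ if $z>1$. Finally, append $DE^{\lfloor (z-1)/2\rfloor}$, where $z\ge1$ is the number of $0$s in row $i$ after the rightmost live entry of row $i$.
   Context: Let $n\ge2$ and $\mathcal{C}_n$ the cycle graph on $\mathbb{Z}_n=\{1,\dots,n\}$ with edges $\{i,i+1\}$ (mod $n$). Independent sets are binary vectors $x\in\{0,1\}^n$ with no two cyclically adjacent $1$s. The toggle $\tau_k$ changes $x_k$ from $1$ to $0$, from $0$ to $1$ if the result is independent, otherwise does nothing; $\tau=\tau_n\circ\cdots\circ\tau_1$, $x^{(i)}=\tau^i(x)$ for $i\in\mathbb{Z}$. The scroll of $x$ is the array $X_{i,j}$ ($i\in\mathbb{Z}$, $j\in\{1,\dots,n\}$) with row $i$ equal to $x^{(i)}$, with convention $X_{i,j+n}=X_{i+1,j}$ (so the scroll read row by row is a bi-infinite sequence); live entries are positions with value $1$. The successor $s$ sends a live $(i,j)$ to the unique live element of $\{(i,j+2),(i+1,j+1)\}$, and the co-successor $c$ sends it to the unique live element of $\{(i+2,j-2),(i+2,j-1)\}$; co-snakes are the orbits of $c$ and $\beta$ is their number. A step $(i,j)\to s(i,j)$ has type $E$ if $s(i,j)=(i,j+2)$ and type $D$ if $s(i,j)=(i+1,j+1)$.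 The slither from a live entry $u$ is the word of step types of $u\to s(u)\to\cdots\to s^{\beta}(u)$. -}

module Defs where

open import Data.Bool using (Bool; true; false; if_then_else_; not; _∧_)
open import Data.Nat as ℕ using (ℕ; zero; suc; NonZero; _≡ᵇ_)
open import Data.Integer as ℤ using (ℤ; +_; -[1+_]; _/ℕ_; _%ℕ_)
open import Data.List using (List; []; _∷_; _++_; replicate; upTo; reverse)
open import Data.Vec using (Vec; []; _∷_)
open import Data.Fin using (Fin)
open import Data.Product using (Σ; ∃; _×_; _,_)
open import Relation.Binary.PropositionalEquality using (_≡_)

-- Configurations on the cycle C_n.  A configuration is x : Vec Bool n;
-- vertex k ∈ {1..n} of the paper is the 0-based index k-1 here.

-- lookup at a natural-number index (0-based; out of range gives false)
get : ∀ {n} → Vec Bool n → ℕ → Bool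
get []      _       = false
get (b ∷ v) zero    = b
get (b ∷ v) (suc k) = get v k

set : ∀ {n} → Vec Bool n → ℕ → Bool → Vec Bool n
set []      _       _ = []
set (b ∷ v) zero    c = c ∷ v
set (b ∷ v) (suc k) c = b ∷ set v k c

right : ℕ → ℕ → ℕ
right n k = if suc k ≡ᵇ n then 0 else suc k

indepAux : ∀ {n} → Vec Bool n → ℕ → Bool
indepAux {n} x zero    = true
indepAux {n} x (suc k) = not (get x k ∧ get x (right n k)) ∧ indepAux x k

indep : ∀ {n} → Vec Bool n → Bool
indep {n} x = indepAux x n

Independent : ∀ {n} → Vec Bool n → Set
Independent x = indep x ≡ true

-- the toggle τ_{k+1} (0-based index k): 1 ↦ 0; 0 ↦ 1 if the result is
-- independent; otherwise nothing.
toggle : ∀ {n} → ℕ → Vec Bool n → Vec Bool n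
toggle k x =
  if get x k then set x k false
  else (if indep (set x k true) then set x k true else x)

applyToggles : ∀ {n} → List ℕ → Vec Bool n → Vec Bool n
applyToggles []       x = x
applyToggles (k ∷ ks) x = applyToggles ks (toggle k x)

τ : ∀ {n} → Vec Bool n → Vec Bool n
τ {n} x = applyToggles (upTo n) x

-- τ⁻¹ = τ_1 ∘ ⋯ ∘ τ_n  (each toggle is an involution on independent sets)
τinv : ∀ {n} → Vec Bool n → Vec Bool n
τinv {n} x = applyToggles (reverse (upTo n)) x

iter : ∀ {A : Set} → ℕ → (A → A) → A → A
iter zero    f a = a
iter (suc k) f a = iter k f (f a)

row : ∀ {n} → Vec Bool n → ℤ → Vec Bool n
row x (+ k)     = iter k τ x
row x -[1+ k ]  = iter (suc k) τinv x

-- Entry (i, j) (i ∈ ℤ, j ∈ {1..n}) is encoded by the integer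
-- p = i·n + (j-1); the convention X_{i,j+n} = X_{i+1,j} is then just
-- p ↦ p + n.

data Letter : Set where
  E D : Letter

module _ {n : ℕ} .{{_ : NonZero n}} (x : Vec Bool n) where

  scroll : ℤ → Bool
  scroll p = get (row x (p /ℕ n)) (p %ℕ n)

  Live : ℤ → Set
  Live p = scroll p ≡ true

  -- successor: the live element of {(i,j+2), (i+1,j+1)} = {p+2, p+n+1}
  succ : ℤ → ℤ
  succ p = if scroll (p ℤ.+ + 2) then p ℤ.+ + 2 else p ℤ.+ + (n ℕ.+ 1)

  -- co-successor: the live element of {(i+2,j-2),(i+2,j-1)} = {p+2n-2, p+2n-1}
  cosucc : ℤ → ℤ
  cosucc p = if scroll (p ℤ.+ + (2 ℕ.* n ℕ.∸ 2))
             then p ℤ.+ + (2 ℕ.* n ℕ.∸ 2)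
             else p ℤ.+ + (2 ℕ.* n ℕ.∸ 1)

  SameCoSnake : ℤ → ℤ → Set
  SameCoSnake p q = ∃ λ k → ∃ λ l → iter k cosucc p ≡ iter l cosucc q

  -- β = b: there are exactly b co-snakes (orbits of c on live entries),
  -- i.e. b live representatives in pairwise distinct orbits covering all
  -- live entries.
  NumCoSnakes : ℕ → Set
  NumCoSnakes b =
    Σ (Fin b → ℤ) λ r →
      (∀ a → Live (r a)) ×
      (∀ a a' → SameCoSnake (r a) (r a') → a ≡ a') ×
      (∀ p → Live p → ∃ λ a → SameCoSnake p (r a))

  stepType : ℤ → Letter
  stepType p = if scroll (p ℤ.+ + 2) then E else D

  slitherLen : ℕ → ℤ → List Letter
  slitherLen zero    u = []
  slitherLen (suc k) u = stepType u ∷ slitherLen k (succ u)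

gaps : List Bool → List ℕ
gaps []          = 0 ∷ []
gaps (true ∷ r)  = 0 ∷ gaps r
gaps (false ∷ r) with gaps r
... | []     = 1 ∷ []
... | z ∷ zs = suc z ∷ zs

blockWord : ℕ → List Letter
blockWord zero          = []
blockWord (suc zero)    = E ∷ []
blockWord z@(suc (suc _)) = D ∷ replicate (z ℕ./ 2 ℕ.∸ 1) E ++ D ∷ []

blocksWord : List ℕ → List Letter
blocksWord []           = []
blocksWord (z ∷ [])     = D ∷ replicate ((z ℕ.∸ 1) ℕ./ 2) E
blocksWord (z ∷ z' ∷ zs) = blockWord z ++ blocksWord (z' ∷ zs)

predicted : List Bool → List Letter
predicted (true ∷ r) = blocksWord (gaps r)
predicted _          = []

-- The scroll of an independent set obeys a local rule: the entry below q is live iff q,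
-- its right neighbour and its left neighbour in the new row are dead.  Below a gap of
-- z zeros between live entries the next row therefore alternates dead, live, dead, …,
-- so the slither steps down, runs right along that row and steps down again (E if
-- z = 1, D E^{⌊z/2⌋-1} D otherwise), landing on the co-snake of the entry closing the
-- gap.  The co-successor keeps step types and commutes with the successor, so the
-- slither continues from there as from that entry; the trailing zeros give D E^{⌊(z-1)/2⌋}.
-- Since the co-successor is a strictly increasing bijection of the live entries, every
-- co-snake meets the window [u, c u) exactly once.  Rows i and i + 1 consist of the
-- window, c u and possibly one dead entry, and hold one live entry more than the word
-- has letters; so β is its length.

module Submission where

open import Defs
open import Data.Bool using (Bool)
open import Data.Nat using (ℕ; NonZero; _≤_)
open import Data.Integer using (ℤ; _*_; +_)
open import Data.Vec using (Vec; toList)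
open import Relation.Binary.PropositionalEquality using (_≡_)

open import Data.Bool using (true; false; if_then_else_; not; _∧_; T)
open import Data.Bool.Properties using (∧-zeroʳ; ∧-identityʳ; ∧-conicalˡ; ∧-conicalʳ; not-involutive)
open import Data.Nat using (zero; suc; _+_; _<_; z≤n; s≤s; _≡ᵇ_; _∸_; _/_)
import Data.Nat as ℕ
open import Data.Nat.Properties
  using (≡ᵇ⇒≡; ≡⇒≡ᵇ; _≟_; _<?_; ≤-refl; ≤-reflexive; ≤-trans; ≤-total; ≤-antisym; ≤-pred; ≤-<-trans;
         <-trans; <-irrefl; <-≤-trans; <⇒≤; ≮⇒≥; n<1+n; n≤1+n; m≤m+n; m≤n+m; m≤n⇒m<n∨m≡n; m≤n⇒∃[o]m+o≡n;
         +-identityʳ; +-suc; +-comm; +-assoc; +-mono-≤; suc-injective)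
open import Data.Nat.DivMod using (m/n≡1+[m∸n]/n)
open import Data.Nat.Induction using (<-rec)
import Data.Nat.Tactic.RingSolver as NatSolver
open import Data.Integer as ℤ using (-[1+_]; 1ℤ; _/ℕ_; _%ℕ_; +≤+; +<+)
import Data.Integer.Properties as ℤP
open import Data.Integer.DivMod using (a≡a%ℕn+[a/ℕn]*n; n%ℕd<d)
import Data.Integer.Tactic.RingSolver as ℤSolver
open import Data.Vec using ([]; _∷_)
open import Data.Vec.Properties using (length-toList)
open import Data.Fin using (Fin; zero; suc)
import Data.Fin.Properties as FinP
open import Data.List using (List; []; _∷_; _++_; upTo; reverse; replicate; length; lookup)
open import Data.List.Properties using (upTo-∷ʳ; unfold-reverse; length-++; length-replicate; ++-identityʳ)
open import Data.List.Relation.Unary.Any using (here; there; index)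
open import Data.List.Relation.Unary.Any.Properties using (lookup-index)
open import Data.List.Membership.Propositional using (_∈_)
open import Data.List.Membership.Propositional.Properties using (∈-lookup)
open import Data.Unit using (⊤)
open import Data.Empty using (⊥; ⊥-elim)
open import Data.Product using (Σ; _×_; _,_; proj₁; proj₂)
open import Data.Sum using (_⊎_; inj₁; inj₂)
open import Relation.Nullary using (yes; no)
open import Relation.Binary.Definitions using (tri<; tri≈; tri>)
open import Relation.Binary.PropositionalEquality
  using (refl; sym; trans; cong; cong₂; subst; subst₂; _≢_; module ≡-Reasoning)

if-true : ∀ {A : Set} {b : Bool} (u v : A) → b ≡ true → (if b then u else v) ≡ u
if-true u v refl = refl

if-false : ∀ {A : Set} {b : Bool} (u v : A) → b ≡ false → (if b then u else v) ≡ v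
if-false u v refl = refl

true-or-false : ∀ (b : Bool) → b ≡ true ⊎ b ≡ false
true-or-false true  = inj₁ refl
true-or-false false = inj₂ refl

true≢false : ∀ {b : Bool} → b ≡ true → b ≢ false
true≢false refl ()

not≡true : ∀ {b} → not b ≡ true → b ≡ false
not≡true {false} _ = refl

∧-false-mono : ∀ {a b a′ b′} → (a′ ≡ true → a ≡ true) → (b′ ≡ true → b ≡ true) →
               (a ∧ b) ≡ false → (a′ ∧ b′) ≡ false
∧-false-mono {a′ = false}               f g e = refl
∧-false-mono {a′ = true} {b′ = false}   f g e = refl
∧-false-mono {a′ = true} {b′ = true}    f g e with f refl | g refl
∧-false-mono {true} {true} {true} {true} f g () | refl | refl

iter-suc : ∀ {A : Set} k (f : A → A) a → iter (suc k) f a ≡ f (iter k f a)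
iter-suc zero    f a = refl
iter-suc (suc k) f a = iter-suc k f (f a)

iter-preserves : ∀ {A : Set} (P : A → Set) (f : A → A) → (∀ a → P a → P (f a)) →
  ∀ k a → P a → P (iter k f a)
iter-preserves P f step zero    a pa = pa
iter-preserves P f step (suc k) a pa = iter-preserves P f step k (f a) (step a pa)

iter-+ : ∀ {A : Set} a b (f : A → A) y → iter (a + b) f y ≡ iter b f (iter a f y)
iter-+ zero    b f y = refl
iter-+ (suc a) b f y = iter-+ a b f (f y)

iter-comm : ∀ {A : Set} a b (f : A → A) y → iter a f (iter b f y) ≡ iter b f (iter a f y)
iter-comm a b f y = trans (sym (iter-+ b a f y)) (trans (cong (λ t → iter t f y) (+-comm b a)) (iter-+ a b f y))

-- Counting, parity and row words

trues : (ℕ → Bool) → ℕ → ℕ → List ℕ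
trues f a zero    = []
trues f a (suc l) = if f a then a ∷ trues f (suc a) l else trues f (suc a) l

count : (ℕ → Bool) → ℕ → ℕ → ℕ
count f a l = length (trues f a l)

count-true : ∀ f a l → f a ≡ true → count f a (suc l) ≡ suc (count f (suc a) l)
count-true f a l e rewrite e = refl

count-false : ∀ f a l → f a ≡ false → count f a (suc l) ≡ count f (suc a) l
count-false f a l e rewrite e = refl

private
  shift-hyp : ∀ (f g : ℕ → Bool) a b {l} → (∀ j → j < suc l → f (a + j) ≡ g (b + j)) →
              ∀ j → j < l → f (suc a + j) ≡ g (suc b + j)
  shift-hyp f g a b h j p = trans (cong f (sym (+-suc a j))) (trans (h (suc j) (s≤s p)) (cong g (+-suc b j)))

count-shift : ∀ f g a b l → (∀ j → j < l → f (a + j) ≡ g (b + j)) → count f a l ≡ count g b l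
count-shift f g a b zero    h = refl
count-shift f g a b (suc l) h with f a in fa | g b in gb | h 0 (s≤s z≤n)
... | true  | true  | _ = cong suc (count-shift f g (suc a) (suc b) l (shift-hyp f g a b h))
... | false | false | _ = count-shift f g (suc a) (suc b) l (shift-hyp f g a b h)
... | true  | false | e₀ rewrite +-identityʳ a | +-identityʳ b = ⊥-elim (true≢false fa (trans e₀ gb))
... | false | true  | e₀ rewrite +-identityʳ a | +-identityʳ b = ⊥-elim (true≢false gb (trans (sym e₀) fa))

count-+ : ∀ f a l m → count f a (l + m) ≡ count f a l + count f (a + l) m
count-+ f a zero    m rewrite +-identityʳ a = refl
count-+ f a (suc l) m with f a
... | true  = cong suc (trans (count-+ f (suc a) l m) (cong (λ t → count f (suc a) l + count f t m) (sym (+-suc a l))))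
... | false = trans (count-+ f (suc a) l m) (cong (λ t → count f (suc a) l + count f t m) (sym (+-suc a l)))

count-none : ∀ f a l → (∀ j → j < l → f (a + j) ≡ false) → count f a l ≡ 0
count-none f a zero    h = refl
count-none f a (suc l) h =
  trans (count-false f a l (trans (cong f (sym (+-identityʳ a))) (h 0 (s≤s z≤n))))
        (count-none f (suc a) l (λ j p → trans (cong f (sym (+-suc a j))) (h (suc j) (s≤s p))))

odd : ℕ → Bool
odd zero    = false
odd (suc j) = not (odd j)

odd-double : ∀ t → odd (t + t) ≡ false
odd-double zero    = refl
odd-double (suc t) rewrite +-suc t t = trans (not-involutive (odd (t + t))) (odd-double t)

odd-suc-double : ∀ t → odd (suc (t + t)) ≡ true
odd-suc-double t = cong not (odd-double t)

count-odd-+2 : ∀ l → count odd 0 (suc (suc l)) ≡ suc (count odd 0 l)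
count-odd-+2 l = trans (count-+ odd 0 2 l) (cong suc (count-shift odd odd 2 0 l (λ j _ → not-involutive (odd j))))

/2-+2 : ∀ w → suc (suc w) / 2 ≡ suc (w / 2)
/2-+2 w = m/n≡1+[m∸n]/n {suc (suc w)} {2} (s≤s (s≤s z≤n))

count-odd : ∀ w → count odd 0 w ≡ w / 2
count-odd zero          = refl
count-odd (suc zero)    = refl
count-odd (suc (suc w)) = trans (count-odd-+2 w) (trans (cong suc (count-odd w)) (sym (/2-+2 w)))

data Parity (w : ℕ) : ℕ → Set where
  is-even : ∀ {m} → w ≡ m + m       → Parity w m
  is-odd  : ∀ {m} → w ≡ suc (m + m) → Parity w m

parity : ∀ w → Σ ℕ λ m → Parity w m × w / 2 ≡ m
parity zero          = 0 , is-even refl , refl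
parity (suc zero)    = 0 , is-odd refl , refl
parity (suc (suc w)) with parity w
... | m , p , w/2≡m = suc m , step p , trans (/2-+2 w) (cong suc w/2≡m)
  where step : Parity w m → Parity (suc (suc w)) (suc m)
        step (is-even e) = is-even (trans (cong (λ t → suc (suc t)) e) (cong suc (sym (+-suc m m))))
        step (is-odd e)  = is-odd (trans (cong (λ t → suc (suc t)) e) (cong (λ t → suc (suc t)) (sym (+-suc m m))))

trues-≥ : ∀ f a l j → j ∈ trues f a l → a ≤ j
trues-≥ f a (suc l) j m with f a
trues-≥ f a (suc l) j (here refl) | true = ≤-refl
trues-≥ f a (suc l) j (there m)   | true = <⇒≤ (trues-≥ f (suc a) l j m)
trues-≥ f a (suc l) j m           | false = <⇒≤ (trues-≥ f (suc a) l j m)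

∈-trues⁻ : ∀ f a l j → j ∈ trues f a l → j < a + l × f j ≡ true
∈-trues⁻ f a (suc l) j m with f a in fa
∈-trues⁻ f a (suc l) j (here refl) | true = ≤-trans (m≤m+n (suc a) l) (≤-reflexive (sym (+-suc a l))) , fa
∈-trues⁻ f a (suc l) j (there m)   | true with ∈-trues⁻ f (suc a) l j m
... | j< , fj = ≤-trans j< (≤-reflexive (sym (+-suc a l))) , fj
∈-trues⁻ f a (suc l) j m           | false with ∈-trues⁻ f (suc a) l j m
... | j< , fj = ≤-trans j< (≤-reflexive (sym (+-suc a l))) , fj

∈-trues⁺ : ∀ f a l j → a ≤ j → j < a + l → f j ≡ true → j ∈ trues f a l
∈-trues⁺ f a zero    j a≤j j< fj = ⊥-elim (<-irrefl refl (≤-<-trans a≤j (subst (j <_) (+-identityʳ a) j<)))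
∈-trues⁺ f a (suc l) j a≤j j< fj with m≤n⇒m<n∨m≡n a≤j
... | inj₂ refl rewrite fj = here refl
... | inj₁ a<j with f a
...   | true  = there (∈-trues⁺ f (suc a) l j a<j (subst (j <_) (+-suc a l) j<) fj)
...   | false = ∈-trues⁺ f (suc a) l j a<j (subst (j <_) (+-suc a l) j<) fj

lookup-trues-injective : ∀ f a l i i′ → lookup (trues f a l) i ≡ lookup (trues f a l) i′ → i ≡ i′
lookup-trues-injective f a (suc l) i i′ e with f a
lookup-trues-injective f a (suc l) zero    zero     e | true = refl
lookup-trues-injective f a (suc l) zero    (suc i′) e | true =
  ⊥-elim (<-irrefl e (trues-≥ f (suc a) l _ (∈-lookup i′)))
lookup-trues-injective f a (suc l) (suc i) zero     e | true =
  ⊥-elim (<-irrefl (sym e) (trues-≥ f (suc a) l _ (∈-lookup i)))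
lookup-trues-injective f a (suc l) (suc i) (suc i′) e | true = cong suc (lookup-trues-injective f (suc a) l i i′ e)
lookup-trues-injective f a (suc l) i       i′       e | false = lookup-trues-injective f (suc a) l i i′ e

blockWord-length : ∀ z → length (blockWord (suc z)) ≡ suc (count odd 0 (suc z))
blockWord-length zero    = refl
blockWord-length (suc w) = begin
  suc (length (replicate (suc (suc w) / 2 ∸ 1) E ++ D ∷ []))  ≡⟨ cong suc (length-++ (replicate (suc (suc w) / 2 ∸ 1) E)) ⟩
  suc (length (replicate (suc (suc w) / 2 ∸ 1) E) + 1)        ≡⟨ cong (λ t → suc (t + 1)) (length-replicate (suc (suc w) / 2 ∸ 1)) ⟩
  suc (suc (suc w) / 2 ∸ 1 + 1)                               ≡⟨ cong (λ t → suc (t ∸ 1 + 1)) (/2-+2 w) ⟩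
  suc (w / 2 + 1)                                             ≡⟨ cong suc (+-comm (w / 2) 1) ⟩
  suc (suc (w / 2))                                           ≡⟨ cong suc (trans (count-odd (suc (suc w))) (/2-+2 w)) ⟨
  suc (count odd 0 (suc (suc w)))                             ∎
  where open ≡-Reasoning

lastBlockWord-length : ∀ z → length (blocksWord (suc z ∷ [])) ≡ count odd 0 (suc (suc z))
lastBlockWord-length z =
  trans (cong suc (length-replicate (z / 2))) (sym (trans (count-odd (suc (suc z))) (/2-+2 z)))

data GapView : List Bool → Set where
  trailing : ∀ z → GapView (replicate z false)
  gap-then : ∀ z {r} → GapView r → GapView (replicate z false ++ true ∷ r)

gapView : ∀ r → GapView r
gapView []          = trailing 0
gapView (true ∷ r)  = gap-then 0 (gapView r)
gapView (false ∷ r) with gapView r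
... | trailing z   = trailing (suc z)
... | gap-then z v = gap-then (suc z) v

gaps-trailing : ∀ z → gaps (replicate z false) ≡ z ∷ []
gaps-trailing zero    = refl
gaps-trailing (suc z) rewrite gaps-trailing z = refl

gaps-gap-then : ∀ z r → gaps (replicate z false ++ true ∷ r) ≡ z ∷ gaps r
gaps-gap-then zero    r = refl
gaps-gap-then (suc z) r rewrite gaps-gap-then z r = refl

blocksWord-gap-then : ∀ z r → blocksWord (z ∷ gaps r) ≡ blockWord z ++ blocksWord (gaps r)
blocksWord-gap-then z []          = refl
blocksWord-gap-then z (true ∷ r)  = refl
blocksWord-gap-then z (false ∷ r) with gaps r
... | []     = refl
... | _ ∷ _  = refl

-- Independent sets and the toggle sweep

get-set-same : ∀ {n} (v : Vec Bool n) k c → k < n → get (set v k c) k ≡ c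
get-set-same (b ∷ v) zero    c _       = refl
get-set-same (b ∷ v) (suc k) c (s≤s p) = get-set-same v k c p

get-set-other : ∀ {n} (v : Vec Bool n) k j c → j ≢ k → get (set v k c) j ≡ get v j
get-set-other []      k       j       c _  = refl
get-set-other (b ∷ v) zero    zero    c ne = ⊥-elim (ne refl)
get-set-other (b ∷ v) zero    (suc j) c ne = refl
get-set-other (b ∷ v) (suc k) zero    c ne = refl
get-set-other (b ∷ v) (suc k) (suc j) c ne = get-set-other v k j c (λ e → ne (cong suc e))

set-set : ∀ {n} (v : Vec Bool n) k a c → set (set v k a) k c ≡ set v k c
set-set []      k       a c = refl
set-set (b ∷ v) zero    a c = refl
set-set (b ∷ v) (suc k) a c = cong (b ∷_) (set-set v k a c)

set-get : ∀ {n} (v : Vec Bool n) k c → get v k ≡ c → set v k c ≡ v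
set-get []      k       c e = refl
set-get (b ∷ v) zero    c e = cong (_∷ v) (sym e)
set-get (b ∷ v) (suc k) c e = cong (b ∷_) (set-get v k c e)

set-beyond : ∀ {n} (v : Vec Bool n) k c → n ≤ k → set v k c ≡ v
set-beyond []      k       c p       = refl
set-beyond (b ∷ v) (suc k) c (s≤s p) = cong (b ∷_) (set-beyond v k c p)

get≡true⇒< : ∀ {n} (v : Vec Bool n) j → get v j ≡ true → j < n
get≡true⇒< (b ∷ v) zero    e = s≤s z≤n
get≡true⇒< (b ∷ v) (suc j) e = s≤s (get≡true⇒< v j e)

get-set-false-≤ : ∀ {n} (v : Vec Bool n) k j → get (set v k false) j ≡ true → get v j ≡ true
get-set-false-≤ []      k       j       e = e
get-set-false-≤ (b ∷ v) zero    (suc j) e = e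
get-set-false-≤ (b ∷ v) (suc k) zero    e = e
get-set-false-≤ (b ∷ v) (suc k) (suc j) e = get-set-false-≤ v k j e

left : ℕ → ℕ → ℕ
left n zero    = n ∸ 1
left n (suc k) = k

right≡suc : ∀ n j → suc j < n → right n j ≡ suc j
right≡suc n j p with suc j ≡ᵇ n in eq
... | true  = ⊥-elim (<-irrefl (≡ᵇ⇒≡ (suc j) n (subst T (sym eq) _)) p)
... | false = refl

right≡0 : ∀ n j → suc j ≡ n → right n j ≡ 0
right≡0 n j p with suc j ≡ᵇ n in eq | ≡⇒≡ᵇ (suc j) n p
... | true | _ = refl

left<n : ∀ n k → k < n → left n k < n
left<n (suc n) zero    p = ≤-refl
left<n n       (suc k) p = <-trans (n<1+n k) p

right∘left : ∀ n k → k < n → right n (left n k) ≡ k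
right∘left (suc n) zero    p = right≡0 (suc n) n refl
right∘left n       (suc k) p = right≡suc n k p

left∘right : ∀ n j → j < n → left n (right n j) ≡ j
left∘right n j p with m≤n⇒m<n∨m≡n p
... | inj₁ q rewrite right≡suc n j q = refl
... | inj₂ q rewrite right≡0 n j q   = cong (_∸ 1) (sym q)

right≢id : ∀ n j → 2 ≤ n → j < n → right n j ≢ j
right≢id n j two p e with m≤n⇒m<n∨m≡n p
... | inj₁ q = suc≢ (trans (sym (right≡suc n j q)) e)
  where suc≢ : ∀ {m} → suc m ≢ m
        suc≢ ()
... | inj₂ q = last≢0 (trans (sym (right≡0 n j q)) e) q two
  where last≢0 : ∀ {j n} → 0 ≡ j → suc j ≡ n → 2 ≤ n → ⊥
        last≢0 refl refl (s≤s ())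

left≢id : ∀ n k → 2 ≤ n → k < n → left n k ≢ k
left≢id n k two p e = right≢id n (left n k) two (left<n n k p) (trans (right∘left n k p) (sym e))

AdjacentFree : ∀ {n} → Vec Bool n → ℕ → Set
AdjacentFree {n} x m = ∀ j → j < m → (get x j ∧ get x (right n j)) ≡ false

indepAux⇒adjacentFree : ∀ {n} (x : Vec Bool n) m → indepAux x m ≡ true → AdjacentFree x m
indepAux⇒adjacentFree {n} x (suc m) e j p with m≤n⇒m<n∨m≡n p
... | inj₁ (s≤s q) = indepAux⇒adjacentFree x m (∧-conicalʳ _ _ e) j q
... | inj₂ refl    = not≡true (∧-conicalˡ _ _ e)

adjacentFree⇒indepAux : ∀ {n} (x : Vec Bool n) m → AdjacentFree x m → indepAux x m ≡ true
adjacentFree⇒indepAux x zero    P = refl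
adjacentFree⇒indepAux x (suc m) P rewrite P m ≤-refl =
  adjacentFree⇒indepAux x m (λ j q → P j (<-trans q (n<1+n m)))

indep⇒adjacentFree : ∀ {n} (x : Vec Bool n) → Independent x → AdjacentFree x n
indep⇒adjacentFree {n} x = indepAux⇒adjacentFree x n

adjacentFree⇒indep : ∀ {n} (x : Vec Bool n) → AdjacentFree x n → Independent x
adjacentFree⇒indep {n} x = adjacentFree⇒indepAux x n

indep-set-false : ∀ {n} (v : Vec Bool n) k → Independent v → Independent (set v k false)
indep-set-false {n} v k e = adjacentFree⇒indep _ λ j p →
  ∧-false-mono (get-set-false-≤ v k j) (get-set-false-≤ v k (right n j)) (indep⇒adjacentFree v e j p)

indep-set-true : ∀ {n} (z : Vec Bool n) k → 2 ≤ n → k < n → Independent z →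
  indep (set z k true) ≡ (not (get z (left n k)) ∧ not (get z (right n k)))
indep-set-true {n} z k two kn iz = bool-ext to from
  where
  z′ : Vec Bool n
  z′ = set z k true
  rk≢k : right n k ≢ k
  rk≢k = right≢id n k two kn
  lk≢k : left n k ≢ k
  lk≢k = left≢id n k two kn
  z′k : get z′ k ≡ true
  z′k = get-set-same z k true kn
  bool-ext : ∀ {a b : Bool} → (a ≡ true → b ≡ true) → (b ≡ true → a ≡ true) → a ≡ b
  bool-ext {false} {false} f g = refl
  bool-ext {false} {true}  f g = g refl
  bool-ext {true}  {false} f g = sym (f refl)
  bool-ext {true}  {true}  f g = refl
  to : Independent z′ → (not (get z (left n k)) ∧ not (get z (right n k))) ≡ true
  to e = cong₂ (λ a b → not a ∧ not b)
             (trans (sym (get-set-other z k (left n k) true lk≢k)) before)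
             (trans (sym (get-set-other z k (right n k) true rk≢k)) after)
    where
    P : AdjacentFree z′ n
    P = indep⇒adjacentFree z′ e
    after : get z′ (right n k) ≡ false
    after = subst (λ b → (b ∧ get z′ (right n k)) ≡ false) z′k (P k kn)
    before : get z′ (left n k) ≡ false
    before = trans (sym (∧-identityʳ _))
      (subst (λ b → (get z′ (left n k) ∧ b) ≡ false) (trans (cong (get z′) (right∘left n k kn)) z′k)
             (P (left n k) (left<n n k kn)))
  from : (not (get z (left n k)) ∧ not (get z (right n k))) ≡ true → Independent z′
  from e = adjacentFree⇒indep z′ free
    where
    lk-dead : get z (left n k) ≡ false
    lk-dead = not≡true (∧-conicalˡ _ _ e)
    rk-dead : get z (right n k) ≡ false
    rk-dead = not≡true (∧-conicalʳ _ _ e)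
    free : AdjacentFree z′ n
    free j jn with j ≟ k
    ... | yes refl = trans (cong (get z′ k ∧_) (trans (get-set-other z k (right n k) true rk≢k) rk-dead))
                           (∧-zeroʳ (get z′ k))
    ... | no j≢k with right n j ≟ k
    ...   | yes rj≡k = cong (_∧ get z′ (right n j)) z′j
      where z′j : get z′ j ≡ false
            z′j = trans (get-set-other z k j true j≢k)
                    (trans (cong (get z) (trans (sym (left∘right n j jn)) (cong (left n) rj≡k))) lk-dead)
    ...   | no rj≢k rewrite get-set-other z k j true j≢k | get-set-other z k (right n j) true rj≢k =
      indep⇒adjacentFree z iz j jn

toggle-indep : ∀ {n} k (y : Vec Bool n) → Independent y → Independent (toggle k y)
toggle-indep k y e with get y k
... | true = indep-set-false y k e
... | false with indep (set y k true) in eq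
...   | true  = eq
...   | false = e

toggle-involutive : ∀ {n} k (y : Vec Bool n) → Independent y → toggle k (toggle k y) ≡ y
toggle-involutive {n} k y iy with get y k in yk
... | true
  rewrite get-set-same y k false (get≡true⇒< y k yk) | set-set y k false true | set-get y k true yk | iy
  = refl
... | false with indep (set y k true) in eq
...   | false rewrite yk | eq = refl
...   | true with k <? n
...     | yes kn rewrite get-set-same y k true kn | set-set y k true false = set-get y k false yk
...     | no k≮n rewrite set-beyond y k true (≮⇒≥ k≮n) | yk | set-beyond y k true (≮⇒≥ k≮n) | eq = refl

applyToggles-indep : ∀ {n} ks (y : Vec Bool n) → Independent y → Independent (applyToggles ks y)
applyToggles-indep []       y e = e
applyToggles-indep (k ∷ ks) y e = applyToggles-indep ks (toggle k y) (toggle-indep k y e)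

applyToggles-++ : ∀ {n} ks ls (y : Vec Bool n) →
  applyToggles (ks ++ ls) y ≡ applyToggles ls (applyToggles ks y)
applyToggles-++ []       ls y = refl
applyToggles-++ (k ∷ ks) ls y = applyToggles-++ ks ls (toggle k y)

applyToggles-reverse : ∀ {n} ks (y : Vec Bool n) → Independent y →
  applyToggles ks (applyToggles (reverse ks) y) ≡ y
applyToggles-reverse []       y e = refl
applyToggles-reverse (k ∷ ks) y e
  rewrite unfold-reverse k ks | applyToggles-++ (reverse ks) (k ∷ []) y =
  trans (cong (applyToggles ks) (toggle-involutive k _ (applyToggles-indep (reverse ks) y e)))
        (applyToggles-reverse ks y e)

τ∘τinv : ∀ {n} (y : Vec Bool n) → Independent y → τ (τinv y) ≡ y
τ∘τinv {n} y = applyToggles-reverse (upTo n) y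

module Rows {n : ℕ} (x : Vec Bool n) (ix : Independent x) where

  row-indep : ∀ r → Independent (row x r)
  row-indep (+ k)    = iter-preserves Independent τ (λ y → applyToggles-indep (upTo n) y) k x ix
  row-indep -[1+ k ] =
    iter-preserves Independent τinv (λ y → applyToggles-indep (reverse (upTo n)) y) (suc k) x ix

  row-suc : ∀ r → row x (r ℤ.+ 1ℤ) ≡ τ (row x r)
  row-suc (+ k) rewrite +-comm k 1 = iter-suc k τ x
  row-suc -[1+ zero ]  = sym (τ∘τinv x ix)
  row-suc -[1+ suc k ] =
    sym (trans (cong τ (iter-suc (suc k) τinv x)) (τ∘τinv _ (row-indep -[1+ k ])))

sweep : ∀ {n} → Vec Bool n → ℕ → Vec Bool n
sweep y j = applyToggles (upTo j) y

sweep-suc : ∀ {n} (y : Vec Bool n) j → sweep y (suc j) ≡ toggle j (sweep y j)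
sweep-suc y j =
  trans (cong (λ l → applyToggles l y) (sym (upTo-∷ʳ j))) (applyToggles-++ (upTo j) (j ∷ []) y)

get-toggle-other : ∀ {n} k (v : Vec Bool n) m → m ≢ k → get (toggle k v) m ≡ get v m
get-toggle-other k v m ne with get v k
... | true = get-set-other v k m false ne
... | false with indep (set v k true)
...   | true  = get-set-other v k m true ne
...   | false = refl

get-sweep-ahead : ∀ {n} (y : Vec Bool n) j m → j ≤ m → get (sweep y j) m ≡ get y m
get-sweep-ahead y zero    m p = refl
get-sweep-ahead y (suc j) m p rewrite sweep-suc y j =
  trans (get-toggle-other j (sweep y j) m (λ e → <-irrefl (sym e) p))
        (get-sweep-ahead y j m (≤-trans (n≤1+n j) p))

get-sweep-behind : ∀ {n} (y : Vec Bool n) j m → m < j → j ≤ n → get (sweep y j) m ≡ get (τ y) m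
get-sweep-behind {n} y j m p q = trans (settled j p) (sym (settled n (≤-trans p q)))
  where
  settled′ : ∀ d → get (sweep y (suc m + d)) m ≡ get (sweep y (suc m)) m
  settled′ zero    rewrite +-identityʳ m = refl
  settled′ (suc d) rewrite +-suc m d | sweep-suc y (suc (m + d)) =
    trans (get-toggle-other (suc (m + d)) (sweep y (suc (m + d))) m (λ e → <-irrefl e (s≤s (m≤m+n m d))))
          (settled′ d)
  settled : ∀ j → m < j → get (sweep y j) m ≡ get (sweep y (suc m)) m
  settled j p with m≤n⇒∃[o]m+o≡n p
  ... | d , refl = settled′ d

get-toggle-self : ∀ {n} k (v : Vec Bool n) → 2 ≤ n → k < n → Independent v →
  get (toggle k v) k ≡ (not (get v (left n k)) ∧ not (get v k) ∧ not (get v (right n k)))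
get-toggle-self {n} k v two kn iv with get v k in vk
... | true  = trans (get-set-same v k false kn) (sym (∧-zeroʳ (not (get v (left n k)))))
... | false with indep (set v k true) in eq
...   | true  = trans (get-set-same v k true kn) (trans (sym eq) (indep-set-true v k two kn iv))
...   | false = trans vk (trans (sym eq) (indep-set-true v k two kn iv))

-- Entry j of τ y is decided when τ_{j+1} is applied, reading the already updated left
-- neighbour and the not yet updated right neighbour.
get-τ : ∀ {n} (y : Vec Bool n) j → 2 ≤ n → j < n → Independent y →
  get (τ y) j ≡ (not (get (sweep y j) (left n j)) ∧ not (get y j) ∧ not (get (sweep y j) (right n j)))
get-τ {n} y j two jn iy = begin
  get (τ y) j                       ≡⟨ get-sweep-behind y (suc j) j ≤-refl jn ⟨
  get (sweep y (suc j)) j           ≡⟨ cong (λ v → get v j) (sweep-suc y j) ⟩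
  get (toggle j (sweep y j)) j      ≡⟨ get-toggle-self j (sweep y j) two jn (applyToggles-indep (upTo j) y iy) ⟩
  not (get (sweep y j) (left n j)) ∧ not (get (sweep y j) j) ∧ not (get (sweep y j) (right n j))
    ≡⟨ cong (λ b → not (get (sweep y j) (left n j)) ∧ not b ∧ not (get (sweep y j) (right n j)))
            (get-sweep-ahead y j j ≤-refl) ⟩
  not (get (sweep y j) (left n j)) ∧ not (get y j) ∧ not (get (sweep y j) (right n j)) ∎
  where open ≡-Reasoning

-- Positions in the scroll

infixl 6 _⊕_

_⊕_ : ℤ → ℕ → ℤ
p ⊕ a = p ℤ.+ + a

⊕-assoc : ∀ p a b → p ⊕ a ⊕ b ≡ p ⊕ (a + b)
⊕-assoc p a b = trans (ℤP.+-assoc p (+ a) (+ b)) (cong (λ t → p ℤ.+ t) (sym (ℤP.pos-+ a b)))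

⊕-identityʳ : ∀ p → p ⊕ 0 ≡ p
⊕-identityʳ = ℤP.+-identityʳ

⊕-⊕ : ∀ p a b {c} → a + b ≡ c → p ⊕ a ⊕ b ≡ p ⊕ c
⊕-⊕ p a b e = trans (⊕-assoc p a b) (cong (p ⊕_) e)

q-d⊕d≡q : ∀ q d → (q ℤ.- + d) ⊕ d ≡ q
q-d⊕d≡q q d = cancel q (+ d)
  where cancel : ∀ q D → (q ℤ.- D) ℤ.+ D ≡ q
        cancel = ℤSolver.solve-∀

⊕-assoc₃ : ∀ p a b c → p ⊕ a ⊕ b ⊕ c ≡ p ⊕ (a + b + c)
⊕-assoc₃ p a b c = trans (cong (_⊕ c) (⊕-assoc p a b)) (⊕-assoc p (a + b) c)

⊕-swap : ∀ p a b → p ⊕ a ⊕ b ≡ p ⊕ b ⊕ a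
⊕-swap p a b = trans (ℤP.+-assoc p (+ a) (+ b)) (trans (cong (λ t → p ℤ.+ t) (ℤP.+-comm (+ a) (+ b)))
                                                         (sym (ℤP.+-assoc p (+ b) (+ a))))

⊕-≤ : ∀ p d → p ℤ.≤ p ⊕ d
⊕-≤ p d = ℤP.i≤i+j p (+ d)

⊕-mono-≤ : ∀ p {a b} → a ≤ b → p ⊕ a ℤ.≤ p ⊕ b
⊕-mono-≤ p a≤b = ℤP.+-monoʳ-≤ p (+≤+ a≤b)

⊕-mono-< : ∀ p {a b} → a < b → p ⊕ a ℤ.< p ⊕ b
⊕-mono-< p a<b = ℤP.+-monoʳ-< p (+<+ a<b)

⊕-cancel-< : ∀ p {a b} → p ⊕ a ℤ.< p ⊕ b → a < b
⊕-cancel-< p {a} {b} lt with a <? b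
... | yes a<b = a<b
... | no  a≮b = ⊥-elim (ℤP.<⇒≱ lt (⊕-mono-≤ p (≮⇒≥ a≮b)))

≤⇒⊕ : ∀ {p q} → p ℤ.≤ q → Σ ℕ λ d → q ≡ p ⊕ d
≤⇒⊕ {p} {q} p≤q = ℤ.∣ q ℤ.- p ∣ , sym (trans (cong (λ t → p ℤ.+ t) (ℤP.0≤i⇒+∣i∣≡i (ℤP.i≤j⇒0≤j-i p≤q))) (cancel p q))
  where cancel : ∀ p q → p ℤ.+ (q ℤ.- p) ≡ q
        cancel = ℤSolver.solve-∀

⊕-injective : ∀ p {a b} → p ⊕ a ≡ p ⊕ b → a ≡ b
⊕-injective p {a} {b} e = ℤP.+-injective (trans (sym (cancel p (+ a))) (trans (cong (ℤ._- p) e) (cancel p (+ b))))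
  where cancel : ∀ p A → (p ℤ.+ A) ℤ.- p ≡ A
        cancel = ℤSolver.solve-∀

<-⊕suc : ∀ p d → p ℤ.< p ⊕ suc d
<-⊕suc p d = subst (ℤ._< p ⊕ suc d) (⊕-identityʳ p) (⊕-mono-< p (s≤s z≤n))

<⇒⊕suc : ∀ {p q} → p ℤ.< q → Σ ℕ λ d → q ≡ p ⊕ suc d
<⇒⊕suc {p} p<q with ≤⇒⊕ (ℤP.<⇒≤ p<q)
... | zero  , refl = ⊥-elim (ℤP.<-irrefl (sym (⊕-identityʳ p)) p<q)
... | suc d , q≡   = d , q≡

pos : ℕ → ℤ → ℕ → ℤ
pos n r j = + j ℤ.+ r ℤ.* + n

pos-⊕ : ∀ n r j a → pos n r j ⊕ a ≡ pos n r (j + a)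
pos-⊕ n r j a = trans (shift (+ j) (+ a) r (+ n)) (cong (ℤ._+ r ℤ.* + n) (sym (ℤP.pos-+ j a)))
  where shift : ∀ J A R N → J ℤ.+ R ℤ.* N ℤ.+ A ≡ J ℤ.+ A ℤ.+ R ℤ.* N
        shift = ℤSolver.solve-∀

pos-carry : ∀ n r j → pos n r (j + n) ≡ pos n (r ℤ.+ 1ℤ) j
pos-carry n r j = trans (cong (ℤ._+ r ℤ.* + n) (ℤP.pos-+ j n)) (carry (+ j) r (+ n))
  where carry : ∀ J R N → J ℤ.+ N ℤ.+ R ℤ.* N ≡ J ℤ.+ (R ℤ.+ 1ℤ) ℤ.* N
        carry = ℤSolver.solve-∀

pos-unique : ∀ {n} .{{_ : NonZero n}} p r j → j < n → p ≡ pos n r j → p /ℕ n ≡ r × p %ℕ n ≡ j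
pos-unique {n} p r j jn p≡ = r′≡r , j′≡j
  where
  r′ : ℤ
  r′ = p /ℕ n
  j′ : ℕ
  j′ = p %ℕ n
  N : ℤ
  N = + n
  p≡′ : p ≡ pos n r′ j′
  p≡′ = a≡a%ℕn+[a/ℕn]*n p n
  rearrange : ∀ (a b c d : ℤ) → a ℤ.+ b ℤ.* N ≡ c ℤ.+ d ℤ.* N → a ≡ c ℤ.+ (d ℤ.- b) ℤ.* N
  rearrange a b c d e = trans (l₁ a b N) (trans (cong (ℤ._- b ℤ.* N) e) (l₂ c d b N))
    where l₁ : ∀ a b N → a ≡ (a ℤ.+ b ℤ.* N) ℤ.- b ℤ.* N
          l₁ = ℤSolver.solve-∀
          l₂ : ∀ c d b N → (c ℤ.+ d ℤ.* N) ℤ.- b ℤ.* N ≡ c ℤ.+ (d ℤ.- b) ℤ.* N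
          l₂ = ℤSolver.solve-∀
  no-carry : ∀ i i′ m → i < n → + i ≢ + i′ ℤ.+ ℤ.+[1+ m ] ℤ.* N
  no-carry i i′ m i<n e = <-irrefl refl (<-≤-trans i<n (≤-trans (m≤n+m n (i′ + m ℕ.* n))
    (≤-reflexive (trans (+-assoc i′ (m ℕ.* n) n)
      (trans (cong (λ t → i′ + t) (+-comm (m ℕ.* n) n)) (sym (ℤP.+-injective e′)))))))
    where e′ : + i ≡ + (i′ + suc m ℕ.* n)
          e′ = trans e (trans (cong (λ t → + i′ ℤ.+ t) (sym (ℤP.pos-* (suc m) n))) (sym (ℤP.pos-+ i′ (suc m ℕ.* n))))
  j≡ : + j ≡ + j′ ℤ.+ (r′ ℤ.- r) ℤ.* N
  j≡ = rearrange (+ j) r (+ j′) r′ (trans (sym p≡) p≡′)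
  j′≡ : + j′ ≡ + j ℤ.+ (r ℤ.- r′) ℤ.* N
  j′≡ = rearrange (+ j′) r′ (+ j) r (trans (sym p≡′) p≡)
  r′≡r : r′ ≡ r
  r′≡r with r′ ℤ.- r in d
  ... | + zero     = ℤP.i-j≡0⇒i≡j r′ r d
  ... | ℤ.+[1+ m ] = ⊥-elim (no-carry j j′ m jn (subst (λ w → + j ≡ + j′ ℤ.+ w ℤ.* N) d j≡))
  ... | -[1+ m ]   = ⊥-elim (no-carry j′ j m (n%ℕd<d p n)
      (trans j′≡ (cong (λ w → + j ℤ.+ w ℤ.* N) (trans (neg-diff r′ r) (cong ℤ.-_ d)))))
    where neg-diff : ∀ (a b : ℤ) → b ℤ.- a ≡ ℤ.- (a ℤ.- b)
          neg-diff = ℤSolver.solve-∀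
  j′≡j : j′ ≡ j
  j′≡j = ℤP.+-injective (trans j′≡ (trans (cong (λ w → + j ℤ.+ (w ℤ.- r′) ℤ.* N) (sym r′≡r))
                                         (cancel (+ j) r′ N)))
    where cancel : ∀ (a r M : ℤ) → a ℤ.+ (r ℤ.- r) ℤ.* M ≡ a
          cancel = ℤSolver.solve-∀

scroll-pos : ∀ {n} .{{_ : NonZero n}} (x : Vec Bool n) r j → j < n → scroll x (pos n r j) ≡ get (row x r) j
scroll-pos {n} x r j jn with pos-unique (pos n r j) r j jn refl
... | r≡ , j≡ = cong₂ (λ a b → get (row x a) b) r≡ j≡

-- Entry q ⊕ n lies below q.  Since τ updates a row from left to right, it is decided by
-- its left neighbour q ⊕ (n - 1) in the new row and by q and q ⊕ 1 in the old one.
LocalRule : (k : ℕ) → Vec Bool (suc (suc k)) → Set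
LocalRule k x = ∀ q → scroll x (q ⊕ suc (suc k)) ≡
                      (not (scroll x (q ⊕ suc k)) ∧ not (scroll x q) ∧ not (scroll x (q ⊕ 1)))

module ScrollRule (k : ℕ) (x : Vec Bool (suc (suc k))) (ix : Independent x) where
  private
    n : ℕ
    n = suc (suc k)
    X : ℤ → Bool
    X = scroll x
    open Rows x ix

  left-in-sweep : ∀ r j → j < n → get (sweep (row x r) j) (left n j) ≡ X (pos n r j ⊕ suc k)
  left-in-sweep r zero    _  = sym (trans (cong X (pos-⊕ n r 0 (suc k))) (scroll-pos x r (suc k) ≤-refl))
  left-in-sweep r (suc j) jn = begin
    get (sweep (row x r) (suc j)) j  ≡⟨ get-sweep-behind (row x r) (suc j) j ≤-refl (<⇒≤ jn) ⟩
    get (τ (row x r)) j              ≡⟨ cong (λ v → get v j) (row-suc r) ⟨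
    get (row x (r ℤ.+ 1ℤ)) j         ≡⟨ scroll-pos x (r ℤ.+ 1ℤ) j (<-trans (n<1+n j) jn) ⟨
    X (pos n (r ℤ.+ 1ℤ) j)           ≡⟨ cong X (pos-carry n r j) ⟨
    X (pos n r (j + n))              ≡⟨ cong (λ c → X (pos n r c)) (+-suc j (suc k)) ⟩
    X (pos n r (suc j + suc k))      ≡⟨ cong X (pos-⊕ n r (suc j) (suc k)) ⟨
    X (pos n r (suc j) ⊕ suc k)      ∎
    where open ≡-Reasoning

  right-in-sweep : ∀ r j → j < n → get (sweep (row x r) j) (right n j) ≡ X (pos n r j ⊕ 1)
  right-in-sweep r j jn with m≤n⇒m<n∨m≡n jn
  ... | inj₁ sj<n rewrite right≡suc n j sj<n = begin
    get (sweep (row x r) j) (suc j)  ≡⟨ get-sweep-ahead (row x r) j (suc j) (n≤1+n j) ⟩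
    get (row x r) (suc j)            ≡⟨ scroll-pos x r (suc j) sj<n ⟨
    X (pos n r (suc j))              ≡⟨ cong X (trans (pos-⊕ n r j 1) (cong (pos n r) (+-comm j 1))) ⟨
    X (pos n r j ⊕ 1)                ∎
    where open ≡-Reasoning
  ... | inj₂ sj≡n rewrite right≡0 n j sj≡n = begin
    get (sweep (row x r) j) 0        ≡⟨ get-sweep-behind (row x r) j 0 (0<j sj≡n) (<⇒≤ jn) ⟩
    get (τ (row x r)) 0              ≡⟨ cong (λ v → get v 0) (row-suc r) ⟨
    get (row x (r ℤ.+ 1ℤ)) 0         ≡⟨ scroll-pos x (r ℤ.+ 1ℤ) 0 (s≤s z≤n) ⟨
    X (pos n (r ℤ.+ 1ℤ) 0)           ≡⟨ cong X (pos-carry n r 0) ⟨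
    X (pos n r n)                    ≡⟨ cong (λ c → X (pos n r c)) (trans (sym sj≡n) (+-comm 1 j)) ⟩
    X (pos n r (j + 1))              ≡⟨ cong X (pos-⊕ n r j 1) ⟨
    X (pos n r j ⊕ 1)                ∎
    where open ≡-Reasoning
          0<j : ∀ {j} → suc j ≡ n → 0 < j
          0<j refl = s≤s z≤n

  local-rule-at : ∀ r j → j < n →
    X (pos n r j ⊕ n) ≡ (not (X (pos n r j ⊕ suc k)) ∧ not (X (pos n r j)) ∧ not (X (pos n r j ⊕ 1)))
  local-rule-at r j jn = begin
    X (pos n r j ⊕ n)           ≡⟨ cong X (trans (pos-⊕ n r j n) (pos-carry n r j)) ⟩
    X (pos n (r ℤ.+ 1ℤ) j)      ≡⟨ scroll-pos x (r ℤ.+ 1ℤ) j jn ⟩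
    get (row x (r ℤ.+ 1ℤ)) j    ≡⟨ cong (λ v → get v j) (row-suc r) ⟩
    get (τ y) j                 ≡⟨ get-τ y j (s≤s (s≤s z≤n)) jn (row-indep r) ⟩
    not (get (sweep y j) (left n j)) ∧ not (get y j) ∧ not (get (sweep y j) (right n j))
      ≡⟨ cong₂ (λ a c → not a ∧ not (get y j) ∧ not c) (left-in-sweep r j jn) (right-in-sweep r j jn) ⟩
    not (X (pos n r j ⊕ suc k)) ∧ not (get y j) ∧ not (X (pos n r j ⊕ 1))
      ≡⟨ cong (λ b → not (X (pos n r j ⊕ suc k)) ∧ not b ∧ not (X (pos n r j ⊕ 1))) (scroll-pos x r j jn) ⟨
    not (X (pos n r j ⊕ suc k)) ∧ not (X (pos n r j)) ∧ not (X (pos n r j ⊕ 1)) ∎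
    where open ≡-Reasoning
          y : Vec Bool n
          y = row x r

  scroll-recurrence : LocalRule k x
  scroll-recurrence q = subst (λ p → X (p ⊕ n) ≡ (not (X (p ⊕ suc k)) ∧ not (X p) ∧ not (X (p ⊕ 1))))
                              (sym (a≡a%ℕn+[a/ℕn]*n q n)) (local-rule-at (q /ℕ n) (q %ℕ n) (n%ℕd<d q n))

-- Slithers and co-snakes under the local rule

Reads : ∀ {n} .{{_ : NonZero n}} (x : Vec Bool n) → ℤ → List Letter → ℤ → Set
Reads x p []      q = p ≡ q
Reads x p (ℓ ∷ w) q = stepType x p ≡ ℓ × Reads x (succ x p) w q

reads-++ : ∀ {n} .{{_ : NonZero n}} (x : Vec Bool n) {p q r w w′} →
  Reads x p w q → Reads x q w′ r → Reads x p (w ++ w′) r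
reads-++ x {w = []}    refl       r₂ = r₂
reads-++ x {w = ℓ ∷ w} (s , r₁)   r₂ = s , reads-++ x r₁ r₂

reads⇒slitherLen : ∀ {n} .{{_ : NonZero n}} (x : Vec Bool n) {p q} w → Reads x p w q → slitherLen x (length w) p ≡ w
reads⇒slitherLen x []      _        = refl
reads⇒slitherLen x (ℓ ∷ w) (s , r)  = cong₂ _∷_ s (reads⇒slitherLen x w r)

module LocalRuleConsequences (k : ℕ) (x : Vec Bool (suc (suc k))) (rule : LocalRule k x) where

  private
    n : ℕ
    n = suc (suc k)
    X : ℤ → Bool
    X = scroll x

  below-dead-of-left : ∀ p → X (p ⊕ suc k) ≡ true → X (p ⊕ n) ≡ false
  below-dead-of-left p e rewrite rule p | e = refl

  below-dead-of-self : ∀ p → X p ≡ true → X (p ⊕ n) ≡ false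
  below-dead-of-self p e rewrite rule p | e = ∧-zeroʳ _

  below-dead-of-right : ∀ p → X (p ⊕ 1) ≡ true → X (p ⊕ n) ≡ false
  below-dead-of-right p e rewrite rule p | e | ∧-zeroʳ (not (X p)) = ∧-zeroʳ _

  below-live : ∀ p → X (p ⊕ suc k) ≡ false → X p ≡ false → X (p ⊕ 1) ≡ false → X (p ⊕ n) ≡ true
  below-live p e₁ e₂ e₃ rewrite rule p | e₁ | e₂ | e₃ = refl

  private
    rebase : ∀ q d a {c} → d + a ≡ c → (q ℤ.- + d) ⊕ c ≡ q ⊕ a
    rebase q d a e = trans (sym (⊕-⊕ (q ℤ.- + d) d a e)) (cong (_⊕ a) (q-d⊕d≡q q d))

  -- q ⊕ 1 lies below q - (k + 1), whose left neighbour in the new row is q;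
  -- q ⊕ (k + 1) lies below q - 1, whose right neighbour is q.
  live⇒right-dead : ∀ q → X q ≡ true → X (q ⊕ 1) ≡ false
  live⇒right-dead q e = subst (λ t → X t ≡ false) (rebase q (suc k) 1 (+-comm (suc k) 1))
    (below-dead-of-left (q ℤ.- + suc k) (subst (λ t → X t ≡ true) (sym (q-d⊕d≡q q (suc k))) e))

  live⇒below-left-dead : ∀ q → X q ≡ true → X (q ⊕ suc k) ≡ false
  live⇒below-left-dead q e = subst (λ t → X t ≡ false) (rebase q 1 (suc k) refl)
    (below-dead-of-right (q ℤ.- + 1) (subst (λ t → X t ≡ true) (sym (q-d⊕d≡q q 1)) e))

  right-live⇒dead : ∀ q → X (q ⊕ 1) ≡ true → X q ≡ false
  right-live⇒dead q e with X q in eq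
  ... | false = refl
  ... | true  = ⊥-elim (true≢false e (live⇒right-dead q eq))

  D-step-live : ∀ q → X q ≡ true → X (q ⊕ 2) ≡ false → X (q ⊕ (n + 1)) ≡ true
  D-step-live q e f = subst (λ t → X t ≡ true) (⊕-⊕ q 1 n (+-comm 1 n))
    (below-live (q ⊕ 1) (subst (λ t → X t ≡ false) (sym (⊕-⊕ q 1 (suc k) refl)) (below-dead-of-self q e))
                        (live⇒right-dead q e)
                        (subst (λ t → X t ≡ false) (sym (⊕-⊕ q 1 1 refl)) f))

  entry-cong : ∀ q {a b} → a ≡ b → X (q ⊕ a) ≡ X (q ⊕ b)
  entry-cong q e = cong (λ t → X (q ⊕ t)) e

  entry-assoc : ∀ q a b → X (q ⊕ a ⊕ b) ≡ X (q ⊕ (a + b))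
  entry-assoc q a b = cong X (⊕-assoc q a b)

  live⇒right-dead-at : ∀ q a → X (q ⊕ a) ≡ true → X (q ⊕ suc a) ≡ false
  live⇒right-dead-at q a e = trans (entry-cong q (+-comm 1 a)) (trans (sym (entry-assoc q a 1)) (live⇒right-dead (q ⊕ a) e))

  live⇒below-dead-at : ∀ q a → X (q ⊕ a) ≡ true → X (q ⊕ (a + n)) ≡ false
  live⇒below-dead-at q a e = trans (sym (entry-assoc q a n)) (below-dead-of-self (q ⊕ a) e)

  live⇒below-left-dead-at : ∀ q a → X (q ⊕ a) ≡ true → X (q ⊕ (a + suc k)) ≡ false
  live⇒below-left-dead-at q a e = trans (sym (entry-assoc q a (suc k))) (live⇒below-left-dead (q ⊕ a) e)

  below-live-at : ∀ q a → X (q ⊕ (a + suc k)) ≡ false → X (q ⊕ a) ≡ false → X (q ⊕ suc a) ≡ false →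
    X (q ⊕ (a + n)) ≡ true
  below-live-at q a e₁ e₂ e₃ = trans (sym (entry-assoc q a n))
    (below-live (q ⊕ a) (trans (entry-assoc q a (suc k)) e₁) e₂ (trans (entry-assoc q a 1) (trans (entry-cong q (+-comm a 1)) e₃)))

  stepType-E : ∀ q → X (q ⊕ 2) ≡ true → stepType x q ≡ E
  stepType-E q = if-true E D

  stepType-D : ∀ q → X (q ⊕ 2) ≡ false → stepType x q ≡ D
  stepType-D q = if-false E D

  succ-E : ∀ q → X (q ⊕ 2) ≡ true → succ x q ≡ q ⊕ 2
  succ-E q = if-true (q ⊕ 2) (q ⊕ (n + 1))

  succ-D : ∀ q → X (q ⊕ 2) ≡ false → succ x q ≡ q ⊕ (n + 1)
  succ-D q = if-false (q ⊕ 2) (q ⊕ (n + 1))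

  succ-live : ∀ q → X q ≡ true → X (succ x q) ≡ true
  succ-live q e with true-or-false (X (q ⊕ 2))
  ... | inj₁ t = trans (cong X (succ-E q t)) t
  ... | inj₂ f = trans (cong X (succ-D q f)) (D-step-live q e f)

  reads-E : ∀ q → X (q ⊕ 2) ≡ true → Reads x q (E ∷ []) (q ⊕ 2)
  reads-E q e = stepType-E q e , succ-E q e

  reads-D : ∀ q → X (q ⊕ 2) ≡ false → Reads x q (D ∷ []) (q ⊕ (n + 1))
  reads-D q e = stepType-D q e , succ-D q e

  reads-E-run : ∀ m q → (∀ t → t < m → X (q ⊕ (suc t + suc t)) ≡ true) →
    Reads x q (replicate m E) (q ⊕ (m + m))
  reads-E-run zero    q live = sym (⊕-identityʳ q)
  reads-E-run (suc m) q live = subst (Reads x q (replicate (suc m) E)) end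
      (reads-++ x {p = q} (reads-E q (live 0 (s≤s z≤n))) (reads-E-run m (q ⊕ 2) live′))
    where
    live′ : ∀ t → t < m → X (q ⊕ 2 ⊕ (suc t + suc t)) ≡ true
    live′ t t<m = trans (cong X (⊕-⊕ q 2 (suc t + suc t) (cong (λ z → suc (suc z)) (sym (+-suc t (suc t))))))
                        (live (suc t) (s≤s t<m))
    end : q ⊕ 2 ⊕ (m + m) ≡ q ⊕ (suc m + suc m)
    end = ⊕-⊕ q 2 (m + m) (cong suc (sym (+-suc m m)))

  reads-live : ∀ p w {q} → X p ≡ true → Reads x p w q → X q ≡ true
  reads-live p []      lp refl     = lp
  reads-live p (ℓ ∷ w) lp (_ , rd) = reads-live (succ x p) w (succ-live p lp) rd

  live-below⇒above-dead : ∀ p → X (p ⊕ n) ≡ true → X (p ⊕ suc k) ≡ false × X p ≡ false × X (p ⊕ 1) ≡ false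
  live-below⇒above-dead p e = all-false _ _ _ (trans (sym (rule p)) e)
    where all-false : ∀ a b c → (not a ∧ not b ∧ not c) ≡ true → a ≡ false × b ≡ false × c ≡ false
          all-false false false false _ = refl , refl , refl

  dead-below⇒above-live : ∀ p → X (p ⊕ n) ≡ false → X (p ⊕ suc k) ≡ false → X p ≡ true ⊎ X (p ⊕ 1) ≡ true
  dead-below⇒above-live p e f = some-true _ _ _ f (trans (sym (rule p)) e)
    where some-true : ∀ a b c → a ≡ false → (not a ∧ not b ∧ not c) ≡ false → b ≡ true ⊎ c ≡ true
          some-true false true  c     _ _ = inj₁ refl
          some-true false false true  _ _ = inj₂ refl

module CosuccConsequences (k : ℕ) (x : Vec Bool (suc (suc k))) (rule : LocalRule k x) where
  open LocalRuleConsequences k x rule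

  private
    n : ℕ
    n = suc (suc k)
    X : ℤ → Bool
    X = scroll x

  -- δ = 2n - 2: the co-successor of q is q ⊕ δ or q ⊕ (δ + 1).
  δ : ℕ
  δ = suc (suc (k + k))

  private
    2n∸2≡δ : 2 ℕ.* n ℕ.∸ 2 ≡ δ
    2n∸2≡δ = trans (+-suc k (suc (k + 0))) (cong suc (trans (+-suc k (k + 0)) (cong (λ t → suc (k + t)) (+-identityʳ k))))

    module Offsets where
      k+1+k+1 : ∀ k → suc k + suc k ≡ suc (suc (k + k))
      k+1+k+1 = NatSolver.solve-∀
      k+1+n : ∀ k → suc k + suc (suc k) ≡ suc (suc (suc (k + k)))
      k+1+n = NatSolver.solve-∀
      n+n : ∀ k → suc (suc k) + suc (suc k) ≡ suc (suc (k + k)) + 2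
      n+n = NatSolver.solve-∀
      n+1+k+1 : ∀ k → suc (suc k) + 1 + suc k ≡ suc (suc (k + k)) + 2
      n+1+k+1 = NatSolver.solve-∀
      n+1+n : ∀ k → suc (suc k) + 1 + suc (suc k) ≡ suc (suc (suc (k + k))) + 2
      n+1+n = NatSolver.solve-∀
      suc-n+k+1 : ∀ k → suc (suc (suc k)) + suc k ≡ suc (suc (suc (suc (k + k))))
      suc-n+k+1 = NatSolver.solve-∀
      suc-n+n : ∀ k → suc (suc (suc k)) + suc (suc k) ≡ suc (suc (suc (k + k))) + 2
      suc-n+n = NatSolver.solve-∀
      δ+1+k+1 : ∀ k → suc (suc (suc (k + k))) + suc k ≡ suc (suc (k + k)) + suc (suc k)
      δ+1+k+1 = NatSolver.solve-∀
      δ+1+n : ∀ k → suc (suc (suc (k + k))) + suc (suc k) ≡ suc (suc k) + 1 + suc (suc (k + k))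
      δ+1+n = NatSolver.solve-∀

  cosucc-near : ∀ q → X (q ⊕ δ) ≡ true → cosucc x q ≡ q ⊕ δ
  cosucc-near q e = trans (if-true _ _ (trans (entry-cong q 2n∸2≡δ) e)) (cong (q ⊕_) 2n∸2≡δ)

  cosucc-far : ∀ q → X (q ⊕ δ) ≡ false → cosucc x q ≡ q ⊕ suc δ
  cosucc-far q e = trans (if-false _ _ (trans (entry-cong q 2n∸2≡δ) e)) (cong (λ t → q ⊕ suc t) 2n∸2≡δ)

  cosucc-far-live : ∀ q → X q ≡ true → X (q ⊕ δ) ≡ false → X (q ⊕ suc δ) ≡ true
  cosucc-far-live q lq fδ = trans (entry-cong q (sym (Offsets.k+1+n k)))
    (below-live-at q (suc k) (trans (entry-cong q (Offsets.k+1+k+1 k)) fδ) (live⇒below-left-dead q lq) (below-dead-of-self q lq))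

  cosucc-live : ∀ q → X q ≡ true → X (cosucc x q) ≡ true
  cosucc-live q lq with true-or-false (X (q ⊕ δ))
  ... | inj₁ t = trans (cong X (cosucc-near q t)) t
  ... | inj₂ f = trans (cong X (cosucc-far q f)) (cosucc-far-live q lq f)

  -- Case analysis on the step type of q (X (q ⊕ 2)) and on the offset of its
  -- co-successor (X (q ⊕ δ)); every entry below is forced by the local rule.
  module _ (q : ℤ) (lq : X q ≡ true) where
    private
      δ+2-if-E-near : X (q ⊕ 2) ≡ true → X (q ⊕ δ) ≡ true → X (q ⊕ (δ + 2)) ≡ true
      δ+2-if-E-near l2 lδ = trans (entry-cong q (sym (Offsets.n+n k)))
        (below-live-at q n (trans (entry-cong q (trans (+-comm n (suc k)) (Offsets.k+1+n k))) (live⇒right-dead-at q δ lδ))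
                           (below-dead-of-self q lq) (live⇒below-left-dead-at q 2 l2))

      δ+2-if-D : X (q ⊕ 2) ≡ false → X (q ⊕ (δ + 2)) ≡ false
      δ+2-if-D f2 = trans (entry-cong q (sym (Offsets.n+1+k+1 k))) (live⇒below-left-dead-at q (n + 1) (D-step-live q lq f2))

      δ+3-if-E-far : X (q ⊕ 2) ≡ true → X (q ⊕ δ) ≡ false → X (q ⊕ (suc δ + 2)) ≡ true
      δ+3-if-E-far l2 fδ = trans (entry-cong q (sym (Offsets.suc-n+n k)))
        (below-live-at q (suc n) (trans (entry-cong q (Offsets.suc-n+k+1 k)) (live⇒right-dead-at q (suc δ) (cosucc-far-live q lq fδ)))
                                 (live⇒below-left-dead-at q 2 l2) (live⇒below-dead-at q 2 l2))

      δ+3-if-D-far : X (q ⊕ 2) ≡ false → X (q ⊕ (suc δ + 2)) ≡ false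
      δ+3-if-D-far f2 = trans (entry-cong q (sym (Offsets.n+1+n k))) (live⇒below-dead-at q (n + 1) (D-step-live q lq f2))

      s+δ-if-D-near : X (q ⊕ 2) ≡ false → X (q ⊕ δ) ≡ true → X (q ⊕ (n + 1 + δ)) ≡ true
      s+δ-if-D-near f2 lδ = trans (entry-cong q (sym (Offsets.δ+1+n k)))
        (below-live-at q (suc δ) (trans (entry-cong q (Offsets.δ+1+k+1 k)) (live⇒below-dead-at q δ lδ))
                                 (live⇒right-dead-at q δ lδ) (trans (entry-cong q (+-comm 2 δ)) (δ+2-if-D f2)))

      s+δ-if-D-far : X (q ⊕ δ) ≡ false → X (q ⊕ (n + 1 + δ)) ≡ false
      s+δ-if-D-far fδ = trans (entry-cong q (sym (Offsets.δ+1+n k))) (live⇒below-dead-at q (suc δ) (cosucc-far-live q lq fδ))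

      after-cosucc : ∀ {c} → cosucc x q ≡ q ⊕ c → X (cosucc x q ⊕ 2) ≡ X (q ⊕ (c + 2))
      after-cosucc e = trans (cong (λ p → X (p ⊕ 2)) e) (entry-assoc q _ 2)

      after-succ : ∀ {s} → succ x q ≡ q ⊕ s → X (succ x q ⊕ δ) ≡ X (q ⊕ (s + δ))
      after-succ e = trans (cong (λ p → X (p ⊕ δ)) e) (entry-assoc q _ δ)

    cosucc-keeps-step : X (cosucc x q ⊕ 2) ≡ X (q ⊕ 2)
    cosucc-keeps-step with true-or-false (X (q ⊕ δ)) | true-or-false (X (q ⊕ 2))
    ... | inj₁ lδ | inj₁ l2 = trans (after-cosucc (cosucc-near q lδ)) (trans (δ+2-if-E-near l2 lδ) (sym l2))
    ... | inj₁ lδ | inj₂ f2 = trans (after-cosucc (cosucc-near q lδ)) (trans (δ+2-if-D f2) (sym f2))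
    ... | inj₂ fδ | inj₁ l2 = trans (after-cosucc (cosucc-far q fδ)) (trans (δ+3-if-E-far l2 fδ) (sym l2))
    ... | inj₂ fδ | inj₂ f2 = trans (after-cosucc (cosucc-far q fδ)) (trans (δ+3-if-D-far f2) (sym f2))

    succ-keeps-cosucc : X (succ x q ⊕ δ) ≡ X (q ⊕ δ)
    succ-keeps-cosucc with true-or-false (X (q ⊕ 2)) | true-or-false (X (q ⊕ δ))
    ... | inj₁ l2 | inj₁ lδ =
      trans (after-succ (succ-E q l2)) (trans (entry-cong q (+-comm 2 δ)) (trans (δ+2-if-E-near l2 lδ) (sym lδ)))
    ... | inj₁ l2 | inj₂ fδ =
      trans (after-succ (succ-E q l2)) (trans (live⇒right-dead-at q (suc δ) (cosucc-far-live q lq fδ)) (sym fδ))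
    ... | inj₂ f2 | inj₁ lδ = trans (after-succ (succ-D q f2)) (trans (s+δ-if-D-near f2 lδ) (sym lδ))
    ... | inj₂ f2 | inj₂ fδ = trans (after-succ (succ-D q f2)) (trans (s+δ-if-D-far fδ) (sym fδ))

  private
    succ-offset : Bool → ℕ
    succ-offset true  = 2
    succ-offset false = n + 1

    cosucc-offset : Bool → ℕ
    cosucc-offset true  = δ
    cosucc-offset false = suc δ

    succ-by : ∀ p {b} → X (p ⊕ 2) ≡ b → succ x p ≡ p ⊕ succ-offset b
    succ-by p {true}  = succ-E p
    succ-by p {false} = succ-D p

    cosucc-by : ∀ p {b} → X (p ⊕ δ) ≡ b → cosucc x p ≡ p ⊕ cosucc-offset b
    cosucc-by p {true}  = cosucc-near p
    cosucc-by p {false} = cosucc-far p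

  stepType-cosucc : ∀ q → X q ≡ true → stepType x (cosucc x q) ≡ stepType x q
  stepType-cosucc q lq = cong (λ b → if b then E else D) (cosucc-keeps-step q lq)

  -- Both steps keep their offsets, so they commute.
  succ∘cosucc : ∀ q → X q ≡ true → succ x (cosucc x q) ≡ cosucc x (succ x q)
  succ∘cosucc q lq = begin
    succ x (cosucc x q)                      ≡⟨ succ-by (cosucc x q) (cosucc-keeps-step q lq) ⟩
    cosucc x q ⊕ succ-offset (X (q ⊕ 2))     ≡⟨ cong (_⊕ succ-offset (X (q ⊕ 2))) (cosucc-by q refl) ⟩
    q ⊕ cosucc-offset (X (q ⊕ δ)) ⊕ succ-offset (X (q ⊕ 2))
                                             ≡⟨ ⊕-swap q _ _ ⟩
    q ⊕ succ-offset (X (q ⊕ 2)) ⊕ cosucc-offset (X (q ⊕ δ))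
                                             ≡⟨ cong (_⊕ cosucc-offset (X (q ⊕ δ))) (succ-by q refl) ⟨
    succ x q ⊕ cosucc-offset (X (q ⊕ δ))     ≡⟨ cosucc-by (succ x q) (succ-keeps-cosucc q lq) ⟨
    cosucc x (succ x q)                      ∎
    where open ≡-Reasoning

  reads-cosucc : ∀ p {r} w → X p ≡ true → Reads x p w r → Reads x (cosucc x p) w (cosucc x r)
  reads-cosucc p []      lp refl      = refl
  reads-cosucc p (ℓ ∷ w) lp (s , rd)  =
    trans (stepType-cosucc p lp) s ,
    subst (λ t → Reads x t w _) (sym (succ∘cosucc p lp)) (reads-cosucc (succ x p) w (succ-live p lp) rd)

  reads-iter-cosucc : ∀ e p {r} w → X p ≡ true → Reads x p w r →
    Reads x (iter e (cosucc x) p) w (iter e (cosucc x) r)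
  reads-iter-cosucc zero    p w lp rd = rd
  reads-iter-cosucc (suc e) p w lp rd = reads-iter-cosucc e (cosucc x p) w (cosucc-live p lp) (reads-cosucc p w lp rd)

module BlockSlithers (k : ℕ) (x : Vec Bool (suc (suc k))) (rule : LocalRule k x) where
  open LocalRuleConsequences k x rule
  open CosuccConsequences k x rule

  private
    n : ℕ
    n = suc (suc k)
    X : ℤ → Bool
    X = scroll x

  entriesFrom : ℤ → ℕ → Bool
  entriesFrom p j = X (p ⊕ j)

  -- Live entries among p, …, p ⊕ (l - 1) and the l entries right below them.
  liveInStrip : ℤ → ℕ → ℕ
  liveInStrip p l = count (entriesFrom p) 0 l + count (entriesFrom p) n l

  -- Below a gap the next row alternates: dead, live, dead, …
  module Gap (p : ℤ) (z : ℕ) (lp : X p ≡ true) (gap : ∀ j → j < z → X (p ⊕ suc j) ≡ false) where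

    below : ℕ → Bool
    below j = X (p ⊕ (n + j))

    below-suc : ∀ j → below (suc j) ≡ (not (below j) ∧ not (X (p ⊕ suc j)) ∧ not (X (p ⊕ suc (suc j))))
    below-suc j = begin
      X (p ⊕ (n + suc j))                        ≡⟨ cong X (⊕-⊕ p (suc j) n (+-comm (suc j) n)) ⟨
      X (p ⊕ suc j ⊕ n)                          ≡⟨ rule (p ⊕ suc j) ⟩
      not (X (p ⊕ suc j ⊕ suc k)) ∧ not (X (p ⊕ suc j)) ∧ not (X (p ⊕ suc j ⊕ 1))
        ≡⟨ cong₂ (λ a c → not a ∧ not (X (p ⊕ suc j)) ∧ not c)
                 (cong X (⊕-⊕ p (suc j) (suc k) (cong suc (trans (+-suc j k) (cong suc (+-comm j k))))))
                 (cong X (⊕-⊕ p (suc j) 1 (+-comm (suc j) 1))) ⟩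
      not (below j) ∧ not (X (p ⊕ suc j)) ∧ not (X (p ⊕ suc (suc j))) ∎
      where open ≡-Reasoning

    below-alternates : ∀ j → j < z → below j ≡ odd j
    below-alternates zero    _    = trans (entry-cong p (+-identityʳ n)) (below-dead-of-self p lp)
    below-alternates (suc j) sj<z
      rewrite below-suc j | below-alternates j (≤-trans (n≤1+n _) sj<z) | gap j (≤-trans (n≤1+n _) sj<z) | gap (suc j) sj<z
      = ∧-identityʳ (not (odd j))

    below-last : ∀ {z′} → z ≡ suc z′ → below z ≡ (not (odd z′) ∧ not (X (p ⊕ suc z)))
    below-last {z′} refl rewrite below-suc z′ | below-alternates z′ ≤-refl | gap z′ ≤-refl = refl

    strip-count : liveInStrip p (suc z) ≡ suc (count odd 0 z + count below z 1)
    strip-count = cong₂ _+_ in-row below-row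
      where
      in-row : count (entriesFrom p) 0 (suc z) ≡ 1
      in-row = trans (count-true (entriesFrom p) 0 z (trans (cong X (⊕-identityʳ p)) lp)) (cong suc (count-none (entriesFrom p) 1 z gap))
      below-row : count (entriesFrom p) n (suc z) ≡ count odd 0 z + count below z 1
      below-row = begin
        count (entriesFrom p) n (suc z)  ≡⟨ count-shift (entriesFrom p) below n 0 (suc z) (λ j _ → refl) ⟩
        count below 0 (suc z)              ≡⟨ cong (count below 0) (+-comm 1 z) ⟩
        count below 0 (z + 1)              ≡⟨ count-+ below 0 z 1 ⟩
        count below 0 z + count below z 1  ≡⟨ cong (_+ count below z 1) (count-shift below odd 0 0 z below-alternates) ⟩
        count odd 0 z + count below z 1    ∎
        where open ≡-Reasoning

    reads-E-run-below : ∀ m → (∀ t → t < m → below (suc (suc t + suc t)) ≡ odd (suc (suc t + suc t))) →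
      Reads x (p ⊕ (n + 1)) (replicate m E) (p ⊕ (n + 1) ⊕ (m + m))
    reads-E-run-below m alt = reads-E-run m (p ⊕ (n + 1)) λ t t<m →
      trans (cong X (⊕-⊕ p (n + 1) (suc t + suc t) (+-assoc n 1 _)))
            (trans (alt t t<m) (odd-suc-double (suc t)))

  private
    module Ends where
      even-last : ∀ k m → suc (suc k) + 1 + (m + m) + 2 ≡ suc (suc (suc (m + m))) + suc (suc k)
      even-last = NatSolver.solve-∀
      even-end : ∀ k m → suc (suc k) + 1 + (m + m) + (suc (suc k) + 1) ≡ suc (suc (suc (m + m))) + suc (suc (suc (k + k)))
      even-end = NatSolver.solve-∀
      odd-last : ∀ k m → suc (suc k) + 1 + (m + m) + 2 ≡ suc (suc k) + suc (suc (suc (m + m)))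
      odd-last = NatSolver.solve-∀
      odd-end : ∀ k m → suc (suc k) + 1 + (m + m) + (suc (suc k) + 1) ≡ suc (suc (suc (suc (m + m)))) + suc (suc (k + k))
      odd-end = NatSolver.solve-∀

  -- A gap of z ≥ 2 is read as D E^{⌊z/2⌋-1} D: down below the gap, right along the
  -- live entries of the alternating row, and down again, landing one co-successor
  -- step after the live entry that closes the gap.
  block-reads : ∀ p z → X p ≡ true → (∀ j → j < z → X (p ⊕ suc j) ≡ false) → X (p ⊕ suc z) ≡ true →
    Σ ℕ λ e → Reads x p (blockWord z) (iter e (cosucc x) (p ⊕ suc z))
  block-reads p zero lp gap la = ⊥-elim (true≢false la (live⇒right-dead p lp))
  block-reads p (suc zero) lp gap la = 0 , reads-E p la
  block-reads p (suc (suc w)) lp gap la with parity w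
  ... | m , par , w/2≡m = 1 , subst₂ (Reads x p) (sym word≡) (lands par) reading
    where
    open Gap p (suc (suc w)) lp gap
    z : ℕ
    z = suc (suc w)
    a q₀ : ℤ
    a = p ⊕ suc z
    q₀ = p ⊕ (n + 1)
    m+m≤w : Parity w m → m + m ≤ w
    m+m≤w (is-even refl) = ≤-refl
    m+m≤w (is-odd refl)  = n≤1+n _
    run : Reads x q₀ (replicate m E) (q₀ ⊕ (m + m))
    run = reads-E-run-below m λ t t<m → below-alternates _ (s≤s (s≤s (≤-trans (+-mono-≤ t<m t<m) (m+m≤w par))))
    last-dead : Parity w m → X (q₀ ⊕ (m + m) ⊕ 2) ≡ false
    last-dead (is-even refl) = trans (cong X (⊕-assoc₃ p (n + 1) (m + m) 2))
      (trans (entry-cong p (Ends.even-last k m)) (trans (cong X (sym (⊕-assoc p (suc z) n))) (below-dead-of-self a la)))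
    last-dead (is-odd refl) = trans (cong X (⊕-assoc₃ p (n + 1) (m + m) 2))
      (trans (entry-cong p (Ends.odd-last k m)) (trans (below-last refl) (trans (cong (λ b → not (odd (suc (suc (m + m)))) ∧ not b) la) (∧-zeroʳ _))))
    word≡ : blockWord z ≡ D ∷ replicate m E ++ D ∷ []
    word≡ = cong (λ t → D ∷ replicate (t ∸ 1) E ++ D ∷ []) (trans (/2-+2 w) (cong suc w/2≡m))
    reading : Reads x p (D ∷ replicate m E ++ D ∷ []) (q₀ ⊕ (m + m) ⊕ (n + 1))
    reading = reads-++ x {p = p} (reads-D p (gap 1 (s≤s (s≤s z≤n))))
                (reads-++ x {p = q₀} run (reads-D (q₀ ⊕ (m + m)) (last-dead par)))
    end-live : X (q₀ ⊕ (m + m) ⊕ (n + 1)) ≡ true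
    end-live = reads-live p (D ∷ replicate m E ++ D ∷ []) lp reading
    lands : Parity w m → q₀ ⊕ (m + m) ⊕ (n + 1) ≡ cosucc x a
    lands (is-even refl) = trans end≡ (sym (cosucc-far a (right-live⇒dead (a ⊕ δ)
                             (trans (cong X (trans (⊕-⊕ a δ 1 (+-comm δ 1)) (sym end≡))) end-live))))
      where end≡ : q₀ ⊕ (m + m) ⊕ (n + 1) ≡ a ⊕ suc δ
            end≡ = trans (⊕-assoc₃ p (n + 1) (m + m) (n + 1)) (trans (cong (p ⊕_) (Ends.even-end k m)) (sym (⊕-assoc p (suc z) (suc δ))))
    lands (is-odd refl) = trans end≡ (sym (cosucc-near a (trans (cong X (sym end≡)) end-live)))
      where end≡ : q₀ ⊕ (m + m) ⊕ (n + 1) ≡ a ⊕ δ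
            end≡ = trans (⊕-assoc₃ p (n + 1) (m + m) (n + 1)) (trans (cong (p ⊕_) (Ends.odd-end k m)) (sym (⊕-assoc p (suc z) δ)))

  block-strip : ∀ p z → X p ≡ true → (∀ j → j < z → X (p ⊕ suc j) ≡ false) → X (p ⊕ suc z) ≡ true →
    liveInStrip p (suc z) ≡ length (blockWord z)
  block-strip p zero     lp gap la = ⊥-elim (true≢false la (live⇒right-dead p lp))
  block-strip p (suc z′) lp gap la = begin
    liveInStrip p (suc (suc z′))                                   ≡⟨ strip-count ⟩
    suc (count odd 0 (suc z′) + count below (suc z′) 1)            ≡⟨ cong (λ c → suc (count odd 0 (suc z′) + c)) (count-false below (suc z′) 0 end-dead) ⟩
    suc (count odd 0 (suc z′) + 0)                                 ≡⟨ cong suc (+-identityʳ _) ⟩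
    suc (count odd 0 (suc z′))                                     ≡⟨ blockWord-length z′ ⟨
    length (blockWord (suc z′))                                    ∎
    where
    open Gap p (suc z′) lp gap
    open ≡-Reasoning
    end-dead : below (suc z′) ≡ false
    end-dead = trans (below-last refl) (trans (cong (λ b → not (odd z′) ∧ not b) la) (∧-zeroʳ _))

  -- The trailing gap of z ≥ 1 zeros of a row ends in front of a dead entry, so the row
  -- below alternates up to its end and the slither reads D E^{⌊(z-1)/2⌋}.
  module LastGap (p : ℤ) (z : ℕ) (lp : X p ≡ true) (gap : ∀ j → j < suc z → X (p ⊕ suc j) ≡ false)
                 (ld : X (p ⊕ suc (suc z)) ≡ false) where
    open Gap p (suc z) lp gap

    below-odd : ∀ j → j ≤ suc z → below j ≡ odd j
    below-odd j j≤ with m≤n⇒m<n∨m≡n j≤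
    ... | inj₁ j< = below-alternates j j<
    ... | inj₂ refl = trans (below-last refl) (trans (cong (λ b → not (odd z) ∧ not b) ld) (∧-identityʳ _))

    last-reads : Σ ℤ (Reads x p (blocksWord (suc z ∷ [])))
    last-reads with parity z
    ... | m , par , z/2≡m = _ , subst (λ w → Reads x p w (p ⊕ (n + 1) ⊕ (m + m))) (sym word≡) (reads-++ x {p = p} (reads-D p two-dead) run)
      where
      word≡ : blocksWord (suc z ∷ []) ≡ D ∷ replicate m E
      word≡ = cong (λ t → D ∷ replicate t E) z/2≡m
      m+m≤z : Parity z m → m + m ≤ z
      m+m≤z (is-even refl) = ≤-refl
      m+m≤z (is-odd refl)  = n≤1+n _
      run : Reads x (p ⊕ (n + 1)) (replicate m E) (p ⊕ (n + 1) ⊕ (m + m))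
      run = reads-E-run-below m λ t t<m → below-odd _ (s≤s (≤-trans (+-mono-≤ t<m t<m) (m+m≤z par)))
      two-dead : X (p ⊕ 2) ≡ false
      two-dead = second-dead z gap ld
        where second-dead : ∀ z → (∀ j → j < suc z → X (p ⊕ suc j) ≡ false) → X (p ⊕ suc (suc z)) ≡ false →
                            X (p ⊕ 2) ≡ false
              second-dead zero    _   d = d
              second-dead (suc _) gap _ = gap 1 (s≤s (s≤s z≤n))

    last-strip : liveInStrip p (suc (suc z)) ≡ suc (length (blocksWord (suc z ∷ [])))
    last-strip = begin
      liveInStrip p (suc (suc z))                                 ≡⟨ strip-count ⟩
      suc (count odd 0 (suc z) + count below (suc z) 1)          ≡⟨ cong (λ b → suc (count odd 0 (suc z) + length (if b then suc z ∷ [] else []))) (below-odd (suc z) ≤-refl) ⟩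
      suc (count odd 0 (suc z) + count odd (suc z) 1)            ≡⟨ cong suc (count-+ odd 0 (suc z) 1) ⟨
      suc (count odd 0 (suc z + 1))                              ≡⟨ cong (λ l → suc (count odd 0 l)) (+-comm (suc z) 1) ⟩
      suc (count odd 0 (suc (suc z)))                            ≡⟨ cong suc (lastBlockWord-length z) ⟨
      suc (length (blocksWord (suc z ∷ [])))                     ∎
      where open ≡-Reasoning

module RowSlithers (k : ℕ) (x : Vec Bool (suc (suc k))) (rule : LocalRule k x) where
  open LocalRuleConsequences k x rule
  open CosuccConsequences k x rule
  open BlockSlithers k x rule

  private
    n : ℕ
    n = suc (suc k)
    X : ℤ → Bool
    X = scroll x

  Spells : ℤ → List Bool → Set
  Spells p []      = ⊤
  Spells p (b ∷ r) = X p ≡ b × Spells (p ⊕ 1) r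

  spells-gap : ∀ p z {r} → Spells p (replicate z false ++ r) →
    (∀ j → j < z → X (p ⊕ j) ≡ false) × Spells (p ⊕ z) r
  spells-gap p zero    {r} spl = (λ j ()) , subst (λ t → Spells t r) (sym (⊕-identityʳ p)) spl
  spells-gap p (suc z) {r} (e , spl) with spells-gap (p ⊕ 1) z spl
  ... | dead , rest = dead′ , subst (λ t → Spells t r) (⊕-⊕ p 1 z refl) rest
    where dead′ : ∀ j → j < suc z → X (p ⊕ j) ≡ false
          dead′ zero    _       = trans (cong X (⊕-identityʳ p)) e
          dead′ (suc j) (s≤s j<) = trans (cong X (sym (⊕-⊕ p 1 j refl))) (dead j j<)

  liveInStrip-+ : ∀ p l m → liveInStrip p (l + m) ≡ liveInStrip p l + liveInStrip (p ⊕ l) m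
  liveInStrip-+ p l m = trans (cong₂ _+_ in-row below)
    (interchange (count (entriesFrom p) 0 l) (count (entriesFrom (p ⊕ l)) 0 m)
                 (count (entriesFrom p) n l) (count (entriesFrom (p ⊕ l)) n m))
    where
    in-row : count (entriesFrom p) 0 (l + m) ≡ count (entriesFrom p) 0 l + count (entriesFrom (p ⊕ l)) 0 m
    in-row = trans (count-+ (entriesFrom p) 0 l m)
      (cong (λ t → count (entriesFrom p) 0 l + t)
            (count-shift (entriesFrom p) (entriesFrom (p ⊕ l)) l 0 m (λ j _ → cong X (sym (⊕-assoc p l j)))))
    below : count (entriesFrom p) n (l + m) ≡ count (entriesFrom p) n l + count (entriesFrom (p ⊕ l)) n m
    below = trans (count-+ (entriesFrom p) n l m)
      (cong (λ t → count (entriesFrom p) n l + t)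
            (count-shift (entriesFrom p) (entriesFrom (p ⊕ l)) (n + l) n m
               (λ j _ → cong X (sym (⊕-⊕ p l (n + j) (shuffle n l j))))))
      where shuffle : ∀ n l j → l + (n + j) ≡ n + l + j
            shuffle = NatSolver.solve-∀
    interchange : ∀ a b c d → (a + b) + (c + d) ≡ (a + c) + (b + d)
    interchange = NatSolver.solve-∀

  RowSlither : ℤ → ℕ → List ℕ → Set
  RowSlither p l gs = Σ ℤ (Reads x p (blocksWord gs)) × liveInStrip p (suc l) ≡ suc (length (blocksWord gs))

  private
    live-after-gap : ∀ p z → X (p ⊕ 1 ⊕ z) ≡ true → X (p ⊕ suc z) ≡ true
    live-after-gap p z e = trans (cong X (sym (⊕-⊕ p 1 z refl))) e

    gap-after : ∀ p z → (∀ j → j < z → X (p ⊕ 1 ⊕ j) ≡ false) → ∀ j → j < z → X (p ⊕ suc j) ≡ false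
    gap-after p z dead j j< = trans (cong X (sym (⊕-⊕ p 1 j refl))) (dead j j<)

  gap-then-slither : ∀ p z r → X p ≡ true → (∀ j → j < z → X (p ⊕ suc j) ≡ false) → X (p ⊕ suc z) ≡ true →
    RowSlither (p ⊕ suc z) (length r) (gaps r) → RowSlither p (suc z + length r) (z ∷ gaps r)
  gap-then-slither p z r lp gap la ((q , rd) , strip) with block-reads p z lp gap la
  ... | e , rd₀ = (_ , subst (λ w → Reads x p w _) (sym (blocksWord-gap-then z r)) reading) , counting
    where
    a : ℤ
    a = p ⊕ suc z
    W : List Letter
    W = blocksWord (gaps r)
    reading : Reads x p (blockWord z ++ W) (iter e (cosucc x) q)
    reading = reads-++ x {p = p} rd₀ (reads-iter-cosucc e a W la rd)
    counting : liveInStrip p (suc (suc z + length r)) ≡ suc (length (blocksWord (z ∷ gaps r)))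
    counting = begin
      liveInStrip p (suc (suc z + length r))              ≡⟨ cong (liveInStrip p) (sym (+-suc (suc z) (length r))) ⟩
      liveInStrip p (suc z + suc (length r))              ≡⟨ liveInStrip-+ p (suc z) (suc (length r)) ⟩
      liveInStrip p (suc z) + liveInStrip a (suc (length r))  ≡⟨ cong₂ _+_ (block-strip p z lp gap la) strip ⟩
      length (blockWord z) + suc (length W)               ≡⟨ +-suc (length (blockWord z)) (length W) ⟩
      suc (length (blockWord z) + length W)               ≡⟨ cong suc (length-++ (blockWord z)) ⟨
      suc (length (blockWord z ++ W))                     ≡⟨ cong (λ w → suc (length w)) (blocksWord-gap-then z r) ⟨
      suc (length (blocksWord (z ∷ gaps r)))              ∎
      where open ≡-Reasoning

  -- r spells the rest of the row; its last entry and the first entry of the next row are dead.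
  row-slither : ∀ p {r} → GapView r → X p ≡ true → Spells (p ⊕ 1) r →
    X (p ⊕ length r) ≡ false → X (p ⊕ suc (length r)) ≡ false → RowSlither p (length r) (gaps r)
  row-slither p (trailing zero) lp _ d₀ _ = ⊥-elim (true≢false (trans (cong X (⊕-identityʳ p)) lp) d₀)
  row-slither p (trailing (suc z)) lp spl _ d₁ =
    subst₂ (RowSlither p) (sym len≡) (sym (gaps-trailing (suc z))) (last-reads , last-strip)
    where
    len≡ : length (replicate (suc z) false) ≡ suc z
    len≡ = length-replicate (suc z)
    dead : ∀ j → j < suc z → X (p ⊕ 1 ⊕ j) ≡ false
    dead = proj₁ (spells-gap (p ⊕ 1) (suc z) {[]} (subst (Spells (p ⊕ 1)) (sym (++-identityʳ _)) spl))
    open LastGap p z lp (gap-after p (suc z) dead) (trans (cong (λ l → X (p ⊕ suc l)) (sym len≡)) d₁)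
  row-slither p (gap-then z {r} v) lp spl d₀ d₁ with spells-gap (p ⊕ 1) z spl
  ... | dead , (la , spl′) =
    subst₂ (RowSlither p) (sym len≡) (sym (gaps-gap-then z r))
      (gap-then-slither p z r lp (gap-after p z dead) la′
        (row-slither a v la′ (subst (λ t → Spells (t ⊕ 1) r) (⊕-⊕ p 1 z refl) spl′)
           (trans (cong X (⊕-assoc p (suc z) (length r))) (trans (cong (λ l → X (p ⊕ l)) (sym len≡)) d₀))
           (trans (cong X (⊕-assoc p (suc z) (suc (length r))))
                  (trans (cong (λ l → X (p ⊕ l)) (trans (+-suc (suc z) (length r)) (cong suc (sym len≡)))) d₁))))
    where
    a : ℤ
    a = p ⊕ suc z
    la′ : X a ≡ true
    la′ = live-after-gap p z la
    len≡ : length (replicate z false ++ true ∷ r) ≡ suc z + length r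
    len≡ = trans (length-++ (replicate z false)) (trans (cong (_+ suc (length r)) (length-replicate z)) (+-suc z (length r)))

  spells-toList : ∀ {m} (v : Vec Bool m) q → (∀ j → j < m → get v j ≡ X (q ⊕ j)) → Spells q (toList v)
  spells-toList []      q entries = _
  spells-toList (b ∷ v) q entries =
    sym (trans (entries 0 (s≤s z≤n)) (cong X (⊕-identityʳ q))) ,
    spells-toList v (q ⊕ 1) (λ j j< → trans (entries (suc j) (s≤s j<)) (cong X (sym (⊕-⊕ q 1 j refl))))

  first-row-slither : ∀ u (v : Vec Bool n) → X u ≡ true → (∀ j → j < n → get v j ≡ X (u ⊕ j)) →
    Σ ℤ (Reads x u (predicted (toList v))) × liveInStrip u n ≡ suc (length (predicted (toList v)))
  first-row-slither u (b ∷ v) lu entries with spells-toList (b ∷ v) u entries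
  ... | ub , spl rewrite sym (trans (sym lu) ub) =
    subst (λ l → RowSlither u l (gaps (toList v))) (length-toList v)
      (row-slither u (gapView (toList v)) lu spl
        (trans (cong (λ l → X (u ⊕ l)) (length-toList v)) (live⇒below-left-dead u lu))
        (trans (cong (λ l → X (u ⊕ suc l)) (length-toList v)) (below-dead-of-self u lu)))

module CoSnakeWindow (k : ℕ) (x : Vec Bool (suc (suc k))) (rule : LocalRule k x) where
  open LocalRuleConsequences k x rule
  open CosuccConsequences k x rule
  open BlockSlithers k x rule using (entriesFrom; liveInStrip)

  private
    n : ℕ
    n = suc (suc k)
    X : ℤ → Bool
    X = scroll x
    c : ℤ → ℤ
    c = cosucc x
    k+1+n : suc k + n ≡ suc δ
    k+1+n = cong suc (trans (+-suc k (suc k)) (cong suc (+-suc k k)))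
    n+n≡2+δ : n + n ≡ 2 + δ
    n+n≡2+δ = cong suc k+1+n

  cosucc-bounds : ∀ q → q ⊕ δ ℤ.≤ c q × c q ℤ.≤ q ⊕ suc δ
  cosucc-bounds q with true-or-false (X (q ⊕ δ))
  ... | inj₁ t = ℤP.≤-reflexive (sym (cosucc-near q t)) , ℤP.≤-trans (ℤP.≤-reflexive (cosucc-near q t)) (⊕-mono-≤ q (n≤1+n δ))
  ... | inj₂ f = ℤP.≤-trans (⊕-mono-≤ q (n≤1+n δ)) (ℤP.≤-reflexive (sym (cosucc-far q f))) , ℤP.≤-reflexive (cosucc-far q f)

  cosucc-increasing : ∀ q → q ℤ.< c q
  cosucc-increasing q = ℤP.<-≤-trans (<-⊕suc q (suc (k + k))) (proj₁ (cosucc-bounds q))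

  -- Two live entries are at distance at least 2, which beats the spread of δ ≤ c q - q ≤ δ + 1.
  cosucc-mono-< : ∀ {p q} → X p ≡ true → X q ≡ true → p ℤ.< q → c p ℤ.< c q
  cosucc-mono-< {p} {q} lp lq p<q with ≤⇒⊕ (ℤP.<⇒≤ p<q)
  ... | zero , refl = ⊥-elim (ℤP.<-irrefl (sym (⊕-identityʳ p)) p<q)
  ... | suc zero , refl = ⊥-elim (true≢false lq (live⇒right-dead p lp))
  ... | suc (suc d) , refl =
    ℤP.≤-<-trans (proj₂ (cosucc-bounds p))
      (ℤP.<-≤-trans (⊕-mono-< p (s≤s (s≤s (m≤n+m δ d))))
        (ℤP.≤-trans (ℤP.≤-reflexive (sym (⊕-assoc p (suc (suc d)) δ))) (proj₁ (cosucc-bounds (p ⊕ suc (suc d))))))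

  cosucc-mono-≤ : ∀ {p q} → X p ≡ true → X q ≡ true → p ℤ.≤ q → c p ℤ.≤ c q
  cosucc-mono-≤ {p} {q} lp lq p≤q with ℤP.<-cmp p q
  ... | tri< p<q _ _ = ℤP.<⇒≤ (cosucc-mono-< lp lq p<q)
  ... | tri≈ _ refl _ = ℤP.≤-refl
  ... | tri> _ _ q<p = ⊥-elim (ℤP.<⇒≱ q<p p≤q)

  cosucc-injective : ∀ {p q} → X p ≡ true → X q ≡ true → c p ≡ c q → p ≡ q
  cosucc-injective {p} {q} lp lq e with ℤP.<-cmp p q
  ... | tri< p<q _ _ = ⊥-elim (ℤP.<-irrefl e (cosucc-mono-< lp lq p<q))
  ... | tri≈ _ p≡q _ = p≡q
  ... | tri> _ _ q<p = ⊥-elim (ℤP.<-irrefl (sym e) (cosucc-mono-< lq lp q<p))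

  iter-cosucc-live : ∀ e q → X q ≡ true → X (iter e c q) ≡ true
  iter-cosucc-live e q = iter-preserves (λ p → X p ≡ true) c cosucc-live e q

  iter-cosucc-injective : ∀ e {p q} → X p ≡ true → X q ≡ true → iter e c p ≡ iter e c q → p ≡ q
  iter-cosucc-injective zero    lp lq eq = eq
  iter-cosucc-injective (suc e) {p} {q} lp lq eq =
    cosucc-injective lp lq (iter-cosucc-injective e (cosucc-live p lp) (cosucc-live q lq) eq)

  iter-cosucc-≥ : ∀ e q → q ℤ.≤ iter e c q
  iter-cosucc-≥ zero    q = ℤP.≤-refl
  iter-cosucc-≥ (suc e) q = ℤP.≤-trans (ℤP.<⇒≤ (cosucc-increasing q)) (iter-cosucc-≥ e (c q))

  -- The live entry b ⊕ (δ + 1), below b ⊕ (k + 1), forces b ⊕ δ and b ⊕ n dead,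
  -- hence b or b ⊕ 1 live.
  cosucc-preimage : ∀ b → X (b ⊕ suc δ) ≡ true → Σ ℤ λ p′ → X p′ ≡ true × c p′ ≡ b ⊕ suc δ
  cosucc-preimage b lp with live-below⇒above-dead (b ⊕ suc k) (trans (cong X (⊕-⊕ b (suc k) n k+1+n)) lp)
  ... | δ-dead , k-dead , n-dead with dead-below⇒above-live b (trans (cong X (sym (⊕-⊕ b (suc k) 1 (+-comm (suc k) 1)))) n-dead) k-dead
  ... | inj₁ lb  = b , lb , cosucc-far b (trans (cong X (sym (⊕-⊕ b (suc k) (suc k) (cong suc (+-suc k k))))) δ-dead)
  ... | inj₂ lb₁ = b ⊕ 1 , lb₁ , trans (cosucc-near (b ⊕ 1) (trans (cong X (⊕-⊕ b 1 δ refl)) lp)) (⊕-⊕ b 1 δ refl)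

  cosucc-surjective : ∀ p → X p ≡ true → Σ ℤ λ p′ → X p′ ≡ true × c p′ ≡ p
  cosucc-surjective p lp with cosucc-preimage (p ℤ.- + suc δ) (subst (λ t → X t ≡ true) (sym (q-d⊕d≡q p (suc δ))) lp)
  ... | p′ , lp′ , e = p′ , lp′ , trans e (q-d⊕d≡q p (suc δ))

  sameCoSnake-sym : ∀ {p q} → SameCoSnake x p q → SameCoSnake x q p
  sameCoSnake-sym (a , b , e) = b , a , sym e

  sameCoSnake-trans : ∀ {p q r} → SameCoSnake x p q → SameCoSnake x q r → SameCoSnake x p r
  sameCoSnake-trans {p} {q} {r} (a , b , e) (a′ , b′ , e′) = a + a′ , b′ + b , (begin
    iter (a + a′) c p       ≡⟨ iter-+ a a′ c p ⟩
    iter a′ c (iter a c p)  ≡⟨ cong (iter a′ c) e ⟩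
    iter a′ c (iter b c q)  ≡⟨ iter-comm a′ b c q ⟩
    iter b c (iter a′ c q)  ≡⟨ cong (iter b c) e′ ⟩
    iter b c (iter b′ c r)  ≡⟨ iter-+ b′ b c r ⟨
    iter (b′ + b) c r       ∎)
    where open ≡-Reasoning

  -- Co-snakes are orbits of the strictly increasing bijection c of the live entries,
  -- so each of them meets the window [u, c u) exactly once.
  module Window (u : ℤ) (lu : X u ≡ true) where

    InWindow : ℤ → Set
    InWindow q = u ℤ.≤ q × q ℤ.< c u

    private
      ahead : ∀ {q q′} a b → X q ≡ true → X q′ ≡ true → InWindow q → InWindow q′ → a ≤ b →
        iter a c q ≡ iter b c q′ → q ≡ q′
      ahead {q} {q′} a b lq lq′ (_ , q<cu) (u≤q′ , _) a≤b e with m≤n⇒∃[o]m+o≡n a≤b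
      ... | zero , refl = iter-cosucc-injective a lq lq′ (trans e (cong (λ t → iter t c q′) (+-identityʳ a)))
      ... | suc d , refl = ⊥-elim (ℤP.<⇒≱ q<cu (ℤP.≤-trans (cosucc-mono-≤ lu lq′ u≤q′)
                              (ℤP.≤-trans (iter-cosucc-≥ d (c q′)) (ℤP.≤-reflexive (sym q≡)))))
        where q≡ : q ≡ iter (suc d) c q′
              q≡ = iter-cosucc-injective a lq (iter-cosucc-live (suc d) q′ lq′)
                     (trans e (trans (iter-+ a (suc d) c q′) (iter-comm (suc d) a c q′)))

    window-unique : ∀ {q q′} → X q ≡ true → X q′ ≡ true → InWindow q → InWindow q′ → SameCoSnake x q q′ → q ≡ q′
    window-unique lq lq′ wq wq′ (a , b , e) with ≤-total a b
    ... | inj₁ a≤b = ahead a b lq lq′ wq wq′ a≤b e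
    ... | inj₂ b≤a = sym (ahead b a lq′ lq wq′ wq b≤a (sym e))

    Represented : ℤ → Set
    Represented p = Σ ℤ λ q → X q ≡ true × InWindow q × SameCoSnake x p q

    private
      closer : ∀ p t t′ → c p ⊕ suc t′ ≡ p ⊕ suc t → t′ < t
      closer p t t′ e = ≤-pred (⊕-cancel-< p (ℤP.<-≤-trans (ℤP.+-monoˡ-< (+ suc t′) (cosucc-increasing p)) (ℤP.≤-reflexive e)))

      from-below : ∀ t p → X p ≡ true → u ≡ p ⊕ suc t → Represented p
      from-below = <-rec (λ t → ∀ p → X p ≡ true → u ≡ p ⊕ suc t → Represented p) step
        where
        step : ∀ t → (∀ {t′} → t′ < t → ∀ p → X p ≡ true → u ≡ p ⊕ suc t′ → Represented p) →
               ∀ p → X p ≡ true → u ≡ p ⊕ suc t → Represented p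
        step t rec p lp u≡ with c p ℤ.<? u
        ... | no cp≮u = c p , cosucc-live p lp ,
                        (ℤP.≮⇒≥ cp≮u , cosucc-mono-< lp lu (subst (p ℤ.<_) (sym u≡) (<-⊕suc p t))) , (1 , 0 , refl)
        ... | yes cp<u with <⇒⊕suc cp<u
        ...   | t′ , u≡′ with rec (closer p t t′ (trans (sym u≡′) u≡)) (c p) (cosucc-live p lp) u≡′
        ...     | q , lq , wq , (a , b , e) = q , lq , wq , (suc a , b , e)

      from-above : ∀ t p → X p ≡ true → p ≡ c u ⊕ t → Represented p
      from-above = <-rec (λ t → ∀ p → X p ≡ true → p ≡ c u ⊕ t → Represented p) step
        where
        step : ∀ t → (∀ {t′} → t′ < t → ∀ p → X p ≡ true → p ≡ c u ⊕ t′ → Represented p) →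
               ∀ p → X p ≡ true → p ≡ c u ⊕ t → Represented p
        step t rec p lp p≡ = via (cosucc-surjective p lp)
          where
          via : (Σ ℤ λ p′ → X p′ ≡ true × c p′ ≡ p) → Represented p
          via (p′ , lp′ , cp′≡p) with p′ ℤ.<? c u
          ... | yes p′<cu = p′ , lp′ , (ℤP.≮⇒≥ (λ p′<u → ℤP.<⇒≱ (subst (ℤ._< c u) cp′≡p (cosucc-mono-< lp′ lu p′<u))
                                                  (subst (c u ℤ.≤_) (sym p≡) (⊕-≤ (c u) t))) , p′<cu) ,
                            (0 , 1 , sym cp′≡p)
          ... | no p′≮cu with ≤⇒⊕ (ℤP.≮⇒≥ p′≮cu)
          ...   | t′ , p′≡ with rec (⊕-cancel-< (c u) (subst₂ ℤ._<_ p′≡ (trans cp′≡p p≡) (cosucc-increasing p′))) p′ lp′ p′≡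
          ...     | q , lq , wq , sc = q , lq , wq , sameCoSnake-trans (0 , 1 , sym cp′≡p) sc

    window-cover : ∀ p → X p ≡ true → Represented p
    window-cover p lp with p ℤ.<? u
    ... | yes p<u with <⇒⊕suc p<u
    ...   | t , u≡ = from-below t p lp u≡
    window-cover p lp | no p≮u with p ℤ.<? c u
    ... | yes p<cu = p , lp , (ℤP.≮⇒≥ p≮u , p<cu) , (0 , 0 , refl)
    ... | no p≮cu with ≤⇒⊕ (ℤP.≮⇒≥ p≮cu)
    ...   | t , p≡ = from-above t p lp p≡

    module _ {d : ℕ} (cu≡ : c u ≡ u ⊕ d) where

      window-offset : ∀ {q} → InWindow q → Σ ℕ λ j → q ≡ u ⊕ j × j < d
      window-offset (u≤q , q<cu) with ≤⇒⊕ u≤q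
      ... | j , q≡ = j , q≡ , ⊕-cancel-< u (subst₂ ℤ._<_ q≡ cu≡ q<cu)

      offset-in-window : ∀ {j} → j < d → InWindow (u ⊕ j)
      offset-in-window j<d = ⊕-≤ u _ , subst (u ⊕ _ ℤ.<_) (sym cu≡) (⊕-mono-< u j<d)

      record WindowOffset (p : ℤ) : Set where
        field
          j    : ℕ
          j<d  : j < d
          live : X (u ⊕ j) ≡ true
          same : SameCoSnake x p (u ⊕ j)

      window-offset-of : ∀ p → X p ≡ true → WindowOffset p
      window-offset-of p lp with window-cover p lp
      ... | q , lq , wq , sc with window-offset wq
      ...   | j , refl , j<d = record { j = j ; j<d = j<d ; live = lq ; same = sc }

      -- Representatives of the co-snakes inject into the live offsets of the window and back.
      numCoSnakes≡window : ∀ β → NumCoSnakes x β → β ≡ count (entriesFrom u) 0 d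
      numCoSnakes≡window β (rep , rep-live , rep-distinct , rep-covers) =
        ≤-antisym (FinP.injective⇒≤ to-injective) (FinP.injective⇒≤ from-injective)
        where
        Q : List ℕ
        Q = trues (entriesFrom u) 0 d

        win : (a : Fin β) → WindowOffset (rep a)
        win a = window-offset-of (rep a) (rep-live a)

        offset∈Q : ∀ a → WindowOffset.j (win a) ∈ Q
        offset∈Q a = ∈-trues⁺ (entriesFrom u) 0 d _ z≤n (WindowOffset.j<d (win a)) (WindowOffset.live (win a))

        to : Fin β → Fin (length Q)
        to a = index (offset∈Q a)

        to-injective : ∀ {a a′} → to a ≡ to a′ → a ≡ a′
        to-injective {a} {a′} e = rep-distinct a a′ (sameCoSnake-trans (WindowOffset.same (win a))
          (subst (λ j → SameCoSnake x (u ⊕ j) (rep a′)) (sym same-offset) (sameCoSnake-sym (WindowOffset.same (win a′)))))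
          where same-offset : WindowOffset.j (win a) ≡ WindowOffset.j (win a′)
                same-offset = trans (lookup-index (offset∈Q a)) (trans (cong (lookup Q) e) (sym (lookup-index (offset∈Q a′))))

        live-at : ∀ i → X (u ⊕ lookup Q i) ≡ true
        live-at i = proj₂ (∈-trues⁻ (entriesFrom u) 0 d (lookup Q i) (∈-lookup i))

        from : Fin (length Q) → Fin β
        from i = proj₁ (rep-covers (u ⊕ lookup Q i) (live-at i))

        from-injective : ∀ {i i′} → from i ≡ from i′ → i ≡ i′
        from-injective {i} {i′} e = lookup-trues-injective (entriesFrom u) 0 d i i′ (⊕-injective u
          (window-unique (live-at i) (live-at i′)
            (offset-in-window (proj₁ (∈-trues⁻ (entriesFrom u) 0 d _ (∈-lookup i))))
            (offset-in-window (proj₁ (∈-trues⁻ (entriesFrom u) 0 d _ (∈-lookup i′))))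
            (sameCoSnake-trans (proj₂ (rep-covers _ (live-at i)))
              (subst (λ a → SameCoSnake x (rep a) (u ⊕ lookup Q i′)) (sym e)
                     (sameCoSnake-sym (proj₂ (rep-covers _ (live-at i′))))))))

  -- Rows i and i + 1 from u: the window [u, c u) plus the live co-successor c u
  -- (and, when c u = u ⊕ δ, the dead entry right after it).
  two-rows-count : ∀ u → X u ≡ true →
    Σ ℕ λ d → c u ≡ u ⊕ d × count (entriesFrom u) 0 (n + n) ≡ suc (count (entriesFrom u) 0 d)
  two-rows-count u lu with true-or-false (X (u ⊕ δ))
  ... | inj₁ lδ = δ , cosucc-near u lδ , (begin
    count (entriesFrom u) 0 (n + n)                                  ≡⟨ cong (count (entriesFrom u) 0) n+n≡δ+2 ⟩
    count (entriesFrom u) 0 (δ + 2)                                  ≡⟨ count-+ (entriesFrom u) 0 δ 2 ⟩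
    count (entriesFrom u) 0 δ + count (entriesFrom u) δ 2            ≡⟨ cong (λ t → count (entriesFrom u) 0 δ + t) last-two ⟩
    count (entriesFrom u) 0 δ + 1                                    ≡⟨ +-comm _ 1 ⟩
    suc (count (entriesFrom u) 0 δ)                                  ∎)
    where
    open ≡-Reasoning
    n+n≡δ+2 : n + n ≡ δ + 2
    n+n≡δ+2 = trans n+n≡2+δ (+-comm 2 δ)
    last-two : count (entriesFrom u) δ 2 ≡ 1
    last-two = trans (count-true (entriesFrom u) δ 1 lδ) (cong suc (count-false (entriesFrom u) (suc δ) 0 (live⇒right-dead-at u δ lδ)))
  ... | inj₂ fδ = suc δ , cosucc-far u fδ , (begin
    count (entriesFrom u) 0 (n + n)                                  ≡⟨ cong (count (entriesFrom u) 0) n+n≡δ+1+1 ⟩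
    count (entriesFrom u) 0 (suc δ + 1)                              ≡⟨ count-+ (entriesFrom u) 0 (suc δ) 1 ⟩
    count (entriesFrom u) 0 (suc δ) + count (entriesFrom u) (suc δ) 1 ≡⟨ cong (λ t → count (entriesFrom u) 0 (suc δ) + t) (count-true (entriesFrom u) (suc δ) 0 (cosucc-far-live u lu fδ)) ⟩
    count (entriesFrom u) 0 (suc δ) + 1                              ≡⟨ +-comm _ 1 ⟩
    suc (count (entriesFrom u) 0 (suc δ))                            ∎)
    where
    open ≡-Reasoning
    n+n≡δ+1+1 : n + n ≡ suc δ + 1
    n+n≡δ+1+1 = trans n+n≡2+δ (+-comm 1 (suc δ))

proposition3p6 : (n : ℕ) .{{_ : NonZero n}} → 2 ≤ n →
  (x : Vec Bool n) → Independent x →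
  (i : ℤ) → Live x (i * + n) →
  (β : ℕ) → NumCoSnakes x β →
  slitherLen x β (i * + n) ≡ predicted (toList (row x i))
proposition3p6 .(suc (suc k)) (s≤s (s≤s (z≤n {k}))) x ix i lu β numCoSnakes = begin
  slitherLen x β u                   ≡⟨ cong (λ b → slitherLen x b u) β≡ ⟩
  slitherLen x (length W) u          ≡⟨ reads⇒slitherLen x W reads ⟩
  W                                  ∎
  where
  open ≡-Reasoning
  n : ℕ
  n = suc (suc k)
  rule : LocalRule k x
  rule = ScrollRule.scroll-recurrence k x ix
  open BlockSlithers k x rule using (entriesFrom; liveInStrip)
  open RowSlithers k x rule using (first-row-slither)
  open CoSnakeWindow k x rule using (two-rows-count; module Window)
  u : ℤ
  u = i * + n
  W : List Letter
  W = predicted (toList (row x i))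
  entries : ∀ j → j < n → get (row x i) j ≡ scroll x (u ⊕ j)
  entries j j<n = sym (trans (cong (scroll x) (ℤP.+-comm u (+ j))) (scroll-pos x i j j<n))
  first-row : Σ ℤ (Reads x u W) × liveInStrip u n ≡ suc (length W)
  first-row = first-row-slither u (row x i) lu entries
  reads : Reads x u W (proj₁ (proj₁ first-row))
  reads = proj₂ (proj₁ first-row)
  β≡ : β ≡ length W
  β≡ with two-rows-count u lu
  ... | d , cu≡ , both-rows = trans (Window.numCoSnakes≡window u lu cu≡ β numCoSnakes)
          (suc-injective (trans (sym both-rows) (trans (count-+ (entriesFrom u) 0 n n) (proj₂ first-row))))
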